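{- For every polynomial time computable function $f:\{0,1\}^*\to\{0,1\}^*$ there exists a $\lambda$-term $t_f$ such that $;\vdash t_f:\mathbf{W}_{\mathrm{Church}}\Rightarrow\mathbf{W}_{\mathrm{Scott}}$ is derivable in $\mathrm{DIAL}$, and for every $w\in\{0,1\}^*$ the $\beta$-normal form of $t_f\,\underline{w}$ is $\overline{f(w)}$.
   Context: $\lambda$-terms: $t::=x\mid\lambda x.t\mid tu$. The system $\mathrm{DIAL}$: linear formulas $L,M::=\alpha\mid\forall\alpha L\mid\mu\alpha L\mid L\multimap M$ (where $\mu\alpha L$ may be formed only if $\alpha$ occurs only positively in $L$); formulas $A,B::=L\mid\forall\alpha A\mid L\multimap B\mid A\Rightarrow B$. Judgments $\Gamma;\Delta\vdash t:A$ where $\Delta$ assigns linear formulas and $\Gamma$ arbitrary formulas to distinct variables. Rules: (ax1) $x:A;\vdash x:A$; (ax2) $;x:L\vdash x:L$; ($\mu_e$) from $\Gamma;\Delta\vdash t:\mu\alpha L$ infer $\Gamma;\Delta\vdash t:L[\mu\alpha L/\alpha]$; ($\mu_i$) the converse; ($\forall_i$) from $\Gamma;\Delta\vdash t:A$ with $\alpha$ not free in $\Gamma,\Delta$ infer $\Gamma;\Delta\vdash t:\forall\alpha A$; ($\forall_e$) from $\Gamma;\Delta\vdash t:\forall\alpha A$ infer $\Gamma;\Delta\vdash t:A[L/\alpha]$ for $L$ linear; ($\Rightarrow_e$) from $\Gamma_1;\Delta\vdash t:A\Rightarrow B$ and $\Gamma_2;\vdash u:A$ infer $\Gamma_1,\Gamma_2;\Delta\vdash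 tu:B$; ($\Rightarrow_i$) from $\Gamma,z:A;\Delta\vdash t:B$ infer $\Gamma;\Delta\vdash\lambda z.t:A\Rightarrow B$; ($\multimap_e$) from $\Gamma_1;\Delta_1\vdash t:L\multimap B$ and $\Gamma_2;\Delta_2\vdash u:L$ infer $\Gamma_1,\Gamma_2;\Delta_1,\Delta_2\vdash tu:B$; ($\multimap_i$) from $\Gamma;\Delta,z:L\vdash t:B$ infer $\Gamma;\Delta\vdash\lambda z.t:L\multimap B$; (Contr) from $\Gamma,x:A,y:A;\Delta\vdash t:B$ infer $\Gamma,z:A;\Delta\vdash t[z/x,z/y]:B$; (Derel) from $\Gamma;\Delta,x:L\vdash t:B$ infer $\Gamma,x:L;\Delta\vdash t:B$; (Weak) from $\Gamma;\Delta\vdash t:B$ infer $\Gamma,\Gamma';\Delta,\Delta'\vdash t:B$. $\mathbf{W}_{\mathrm{Church}}=\forall\alpha(\alpha\multimap\alpha)\Rightarrow(\alpha\multimap\alpha)\Rightarrow(\alpha\multimap\alpha)$, $\underline{w}=\lambda f_0f_1x.f_{i_1}(f_{i_2}(\cdots f_{i_n}(x)\cdots))$ for $w=i_1\cdots i_n$; $\mathbf{W}_{\mathrm{Scott}}=\mu\beta\forall\alpha(\beta\multimap\alpha)\multimap(\beta\multimap\alpha)\multimap(\alpha\multimap\alpha)$, $\overline{\epsilon}=\lambda xyz.z$, $\overline{0w}=\lambda xyz.x\,\overline{w}$, $\overline{1w}=\lambda xyz.y\,\overline{w}$. -}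

module Defs where

open import Data.Nat using (ℕ; zero; suc; _+_; _*_; _^_; _≤_; _≡ᵇ_)
open import Data.Bool using (Bool; true; false; if_then_else_)
open import Data.Fin using (Fin; zero; suc)
open import Data.List using (List; []; _∷_; _++_; map; length)
open import Data.List.Relation.Unary.Unique.Propositional using (Unique)
open import Data.List.Relation.Binary.Permutation.Propositional using (_↭_)
open import Data.Maybe using (Maybe; just; nothing)
open import Data.Product using (_×_; _,_; proj₁; Σ; ∃; ∃-syntax)
open import Data.Unit using (⊤)
open import Data.Sum using (_⊎_)
open import Data.Empty using (⊥)
open import Relation.Nullary using (¬_)
open import Relation.Binary.PropositionalEquality using (_≡_; _≢_)
open import Relation.Binary.Construct.Closure.ReflexiveTransitive using (Star)

data Tm : Set where
  var : ℕ → Tm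
  lam : ℕ → Tm → Tm
  app : Tm → Tm → Tm

-- renaming of the free occurrences of x by z (no capture avoidance;
-- it is only used under the side condition that z is not bound in t)
ren : ℕ → ℕ → Tm → Tm
ren x z (var y) = if y ≡ᵇ x then var z else var y
ren x z (lam y t) = if y ≡ᵇ x then lam y t else lam y (ren x z t)
ren x z (app t u) = app (ren x z t) (ren x z u)

BoundIn : ℕ → Tm → Set
BoundIn z (var y) = ⊥
BoundIn z (lam y t) = (z ≡ y) ⊎ BoundIn z t
BoundIn z (app t u) = BoundIn z t ⊎ BoundIn z u

-- de Bruijn λ-terms and β-reduction (to speak about terms up to α)

data Λ : Set where
  ` : ℕ → Λ
  ƛ : Λ → Λ
  _·_ : Λ → Λ → Λ

ext : (ℕ → ℕ) → ℕ → ℕ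
ext ρ zero = zero
ext ρ (suc n) = suc (ρ n)

rename : (ℕ → ℕ) → Λ → Λ
rename ρ (` n) = ` (ρ n)
rename ρ (ƛ t) = ƛ (rename (ext ρ) t)
rename ρ (t · u) = rename ρ t · rename ρ u

exts : (ℕ → Λ) → ℕ → Λ
exts σ zero = ` zero
exts σ (suc n) = rename suc (σ n)

subst : (ℕ → Λ) → Λ → Λ
subst σ (` n) = σ n
subst σ (ƛ t) = ƛ (subst (exts σ) t)
subst σ (t · u) = subst σ t · subst σ u

single : Λ → ℕ → Λ
single u zero = u
single u (suc n) = ` n

_[_] : Λ → Λ → Λ
t [ u ] = subst (single u) t

data _⟶β_ : Λ → Λ → Set where
  β   : ∀ {t u} → (ƛ t · u) ⟶β (t [ u ])
  ξƛ  : ∀ {t t'} → t ⟶β t' → ƛ t ⟶β ƛ t'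
  ξₗ  : ∀ {t t' u} → t ⟶β t' → (t · u) ⟶β (t' · u)
  ξᵣ  : ∀ {t u u'} → u ⟶β u' → (t · u) ⟶β (t · u')

_⟶β*_ : Λ → Λ → Set
_⟶β*_ = Star _⟶β_

BetaNormal : Λ → Set
BetaNormal t = ∀ t' → ¬ (t ⟶β t')

IsBetaNF : Λ → Λ → Set
IsBetaNF t v = (t ⟶β* v) × BetaNormal v

-- conversion named → de Bruijn (free variable x at depth d becomes d + x)
idx : List ℕ → ℕ → ℕ
idx [] x = x
idx (y ∷ env) x = if y ≡ᵇ x then zero else suc (idx env x)

toDB : List ℕ → Tm → Λ
toDB env (var x) = ` (idx env x)
toDB env (lam x t) = ƛ (toDB (x ∷ env) t)
toDB env (app t u) = toDB env t · toDB env u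

-- Formulas of DIAL, type variables as de Bruijn indices
-- (all and mu bind index 0)

infixr 5 _⊸_ _⇒_

data Ty : Set where
  tv  : ℕ → Ty
  all : Ty → Ty
  mu  : Ty → Ty
  _⊸_ : Ty → Ty → Ty
  _⇒_ : Ty → Ty → Ty

mutual
  Pos : ℕ → Ty → Set
  Pos n (tv m) = ⊤
  Pos n (all A) = Pos (suc n) A
  Pos n (mu A) = Pos (suc n) A
  Pos n (A ⊸ B) = Neg n A × Pos n B
  Pos n (A ⇒ B) = Neg n A × Pos n B

  Neg : ℕ → Ty → Set
  Neg n (tv m) = m ≢ n
  Neg n (all A) = Neg (suc n) A
  Neg n (mu A) = Neg (suc n) A
  Neg n (A ⊸ B) = Pos n A × Neg n B
  Neg n (A ⇒ B) = Pos n A × Neg n B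

data Lin : Ty → Set where
  tv  : ∀ n → Lin (tv n)
  all : ∀ {L} → Lin L → Lin (all L)
  mu  : ∀ {L} → Lin L → Pos zero L → Lin (mu L)
  _⊸_ : ∀ {L M} → Lin L → Lin M → Lin (L ⊸ M)

data Fm : Ty → Set where
  lin : ∀ {L} → Lin L → Fm L
  all : ∀ {A} → Fm A → Fm (all A)
  _⊸_ : ∀ {L B} → Lin L → Fm B → Fm (L ⊸ B)
  _⇒_ : ∀ {A B} → Fm A → Fm B → Fm (A ⇒ B)

renTy : (ℕ → ℕ) → Ty → Ty
renTy ρ (tv n) = tv (ρ n)
renTy ρ (all A) = all (renTy (ext ρ) A)
renTy ρ (mu A) = mu (renTy (ext ρ) A)
renTy ρ (A ⊸ B) = renTy ρ A ⊸ renTy ρ B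
renTy ρ (A ⇒ B) = renTy ρ A ⇒ renTy ρ B

extsTy : (ℕ → Ty) → ℕ → Ty
extsTy σ zero = tv zero
extsTy σ (suc n) = renTy suc (σ n)

subTy : (ℕ → Ty) → Ty → Ty
subTy σ (tv n) = σ n
subTy σ (all A) = all (subTy (extsTy σ) A)
subTy σ (mu A) = mu (subTy (extsTy σ) A)
subTy σ (A ⊸ B) = subTy σ A ⊸ subTy σ B
subTy σ (A ⇒ B) = subTy σ A ⇒ subTy σ B

singleTy : Ty → ℕ → Ty
singleTy L zero = L
singleTy L (suc n) = tv n

_[_]ᵗ : Ty → Ty → Ty
A [ L ]ᵗ = subTy (singleTy L) A

Ctx : Set
Ctx = List (ℕ × Ty)

dom : Ctx → List ℕ
dom = map proj₁

AllFm : Ctx → Set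
AllFm [] = ⊤
AllFm ((x , A) ∷ Γ) = Fm A × AllFm Γ

AllLin : Ctx → Set
AllLin [] = ⊤
AllLin ((x , A) ∷ Γ) = Lin A × AllLin Γ

-- shift free type variables (α not free in Γ,Δ, de Bruijn style)
shiftCtx : Ctx → Ctx
shiftCtx = map (λ p → proj₁ p , renTy suc (Data.Product.proj₂ p))

Distinct : Ctx → Ctx → Set
Distinct Γ Δ = Unique (dom Γ ++ dom Δ)

infix 4 _⨾_⊢_∶_

data _⨾_⊢_∶_ : Ctx → Ctx → Tm → Ty → Set where
  ax1 : ∀ {x A} → Fm A → ((x , A) ∷ []) ⨾ [] ⊢ var x ∶ A
  ax2 : ∀ {x L} → Lin L → [] ⨾ ((x , L) ∷ []) ⊢ var x ∶ L
  μₑ : ∀ {Γ Δ t L} → Γ ⨾ Δ ⊢ t ∶ mu L → Γ ⨾ Δ ⊢ t ∶ L [ mu L ]ᵗ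
  μᵢ : ∀ {Γ Δ t L} → Lin (mu L) → Γ ⨾ Δ ⊢ t ∶ L [ mu L ]ᵗ → Γ ⨾ Δ ⊢ t ∶ mu L
  ∀ᵢ : ∀ {Γ Δ t A} → shiftCtx Γ ⨾ shiftCtx Δ ⊢ t ∶ A → Γ ⨾ Δ ⊢ t ∶ all A
  ∀ₑ : ∀ {Γ Δ t A L} → Lin L → Γ ⨾ Δ ⊢ t ∶ all A → Γ ⨾ Δ ⊢ t ∶ A [ L ]ᵗ
  ⇒ₑ : ∀ {Γ₁ Γ₂ Δ t u A B} → Distinct (Γ₁ ++ Γ₂) Δ →
       Γ₁ ⨾ Δ ⊢ t ∶ A ⇒ B → Γ₂ ⨾ [] ⊢ u ∶ A → (Γ₁ ++ Γ₂) ⨾ Δ ⊢ app t u ∶ B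
  ⇒ᵢ : ∀ {Γ Δ z t A B} → (Γ ++ (z , A) ∷ []) ⨾ Δ ⊢ t ∶ B → Γ ⨾ Δ ⊢ lam z t ∶ A ⇒ B
  ⊸ₑ : ∀ {Γ₁ Γ₂ Δ₁ Δ₂ t u L B} → Distinct (Γ₁ ++ Γ₂) (Δ₁ ++ Δ₂) →
       Γ₁ ⨾ Δ₁ ⊢ t ∶ L ⊸ B → Γ₂ ⨾ Δ₂ ⊢ u ∶ L →
       (Γ₁ ++ Γ₂) ⨾ (Δ₁ ++ Δ₂) ⊢ app t u ∶ B
  ⊸ᵢ : ∀ {Γ Δ z t L B} → Γ ⨾ (Δ ++ (z , L) ∷ []) ⊢ t ∶ B → Γ ⨾ Δ ⊢ lam z t ∶ L ⊸ B
  contr : ∀ {Γ Δ x y z t A B} → Distinct (Γ ++ (z , A) ∷ []) Δ → ¬ BoundIn z t →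
       (Γ ++ (x , A) ∷ (y , A) ∷ []) ⨾ Δ ⊢ t ∶ B →
       (Γ ++ (z , A) ∷ []) ⨾ Δ ⊢ ren y z (ren x z t) ∶ B
  derel : ∀ {Γ Δ x t L B} → Γ ⨾ (Δ ++ (x , L) ∷ []) ⊢ t ∶ B →
       (Γ ++ (x , L) ∷ []) ⨾ Δ ⊢ t ∶ B
  weak : ∀ {Γ Γ' Δ Δ' t B} → AllFm Γ' → AllLin Δ' → Distinct (Γ ++ Γ') (Δ ++ Δ') →
       Γ ⨾ Δ ⊢ t ∶ B → (Γ ++ Γ') ⨾ (Δ ++ Δ') ⊢ t ∶ B
  -- contexts are finite sets of declarations: order is irrelevant
  exch : ∀ {Γ Γ' Δ Δ' t B} → Γ ↭ Γ' → Δ ↭ Δ' → Γ ⨾ Δ ⊢ t ∶ B → Γ' ⨾ Δ' ⊢ t ∶ B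

WChurch : Ty
WChurch = all ((tv 0 ⊸ tv 0) ⇒ (tv 0 ⊸ tv 0) ⇒ (tv 0 ⊸ tv 0))

-- μβ ∀α (β ⊸ α) ⊸ (β ⊸ α) ⊸ (α ⊸ α)   (inside: β = index 1, α = index 0)
WScott : Ty
WScott = mu (all ((tv 1 ⊸ tv 0) ⊸ (tv 1 ⊸ tv 0) ⊸ (tv 0 ⊸ tv 0)))

-- words in {0,1}*: false = 0, true = 1
Word : Set
Word = List Bool

-- underline w = λ f0 f1 x. f_{i1} (... (f_{in} x))   with f0 = 0, f1 = 1, x = 2
churchBody : Word → Tm
churchBody [] = var 2
churchBody (b ∷ w) = app (var (if b then 1 else 0)) (churchBody w)

church : Word → Tm
church w = lam 0 (lam 1 (lam 2 (churchBody w)))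

scott : Word → Tm
scott [] = lam 0 (lam 1 (lam 2 (var 2)))
scott (false ∷ w) = lam 0 (lam 1 (lam 2 (app (var 0) (scott w))))
scott (true ∷ w) = lam 0 (lam 1 (lam 2 (app (var 1) (scott w))))

-- Polynomial time computability: deterministic single-tape Turing machines
-- with a two-way infinite tape over alphabet Fin (3 + k), where
-- 0 = blank, 1 = bit 0, 2 = bit 1, and any extra work symbols.

data Move : Set where
  left right : Move

record TM : Set where
  field
    nQ    : ℕ
    k     : ℕ
    start : Fin nQ
    -- nothing = the machine halts
    δ     : Fin nQ → Fin (3 + k) → Maybe (Fin nQ × Fin (3 + k) × Move)

record Config (nQ k : ℕ) : Set where
  constructor conf
  field
    st : Fin nQ
    lt : List (Fin (3 + k))   -- cells left of the head, nearest first
    hd : Fin (3 + k)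
    rt : List (Fin (3 + k))   -- cells right of the head, nearest first

blank : ∀ {k} → Fin (3 + k)
blank = zero

encBit : ∀ {k} → Bool → Fin (3 + k)
encBit false = suc zero
encBit true = suc (suc zero)

moveHead : ∀ {nQ k} → Fin nQ → Fin (3 + k) → Move →
           List (Fin (3 + k)) → List (Fin (3 + k)) → Config nQ k
moveHead q a left [] r = conf q [] blank (a ∷ r)
moveHead q a left (l ∷ ls) r = conf q ls l (a ∷ r)
moveHead q a right l [] = conf q (a ∷ l) blank []
moveHead q a right l (r ∷ rs) = conf q (a ∷ l) r rs

stepAux : ∀ {nQ k} → Config nQ k → Maybe (Fin nQ × Fin (3 + k) × Move) → Config nQ k
stepAux c nothing = c
stepAux (conf q l a r) (just (q' , a' , m)) = moveHead q' a' m l r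

step : (M : TM) → Config (TM.nQ M) (TM.k M) → Config (TM.nQ M) (TM.k M)
step M c = stepAux c (TM.δ M (Config.st c) (Config.hd c))

run : (M : TM) → ℕ → Config (TM.nQ M) (TM.k M) → Config (TM.nQ M) (TM.k M)
run M zero c = c
run M (suc n) c = run M n (step M c)

Halted : (M : TM) → Config (TM.nQ M) (TM.k M) → Set
Halted M c = TM.δ M (Config.st c) (Config.hd c) ≡ nothing

initConf : (M : TM) → Word → Config (TM.nQ M) (TM.k M)
initConf M [] = conf (TM.start M) [] blank []
initConf M (b ∷ w) = conf (TM.start M) [] (encBit b) (map encBit w)

-- output: the maximal bit string starting at the head, read rightwards
readBits : ∀ {k} → List (Fin (3 + k)) → Word
readBits [] = []
readBits (zero ∷ as) = []
readBits (suc zero ∷ as) = false ∷ readBits as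
readBits (suc (suc zero) ∷ as) = true ∷ readBits as
readBits (suc (suc (suc _)) ∷ as) = []

output : ∀ {nQ k} → Config nQ k → Word
output c = readBits (Config.hd c ∷ Config.rt c)

ComputesInTime : TM → (ℕ → ℕ) → (Word → Word) → Set
ComputesInTime M T f = ∀ w → ∃[ n ] (n ≤ T (length w)
  × Halted M (run M n (initConf M w))
  × output (run M n (initConf M w)) ≡ f w)

PolyTimeComputable : (Word → Word) → Set
PolyTimeComputable f = ∃[ M ] ∃[ c ] ∃[ d ] ComputesInTime M (λ n → c * n ^ d + c) f

-- A polynomial-time machine is simulated in DIAL with linear data only: the state and
-- the scanned symbol are Scott numerals and the two halves of the tape Scott lists, so
-- one machine step is a closed term of type Cfg ⊸ Cfg defined by case distinction on
-- state and symbol. Only the Church input word is duplicated: the combinator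
-- λq x s. x (q x) (q x) (q x s) turns an iterator running g(n) times on words of length n
-- into one running (n + 1) g(n) times, so d amplifications of a loop of length 2c run at
-- least c n^d + c steps, and a halted configuration is a fixpoint of the step, so
-- running longer does no harm. A second loop of this kind copies the bits from the head
-- rightwards into a Scott word. Typing derivations are obtained by evaluating a checker
-- on annotated terms, and reductions by evaluating head reduction on de Bruijn terms in
-- which known closed values are opaque constants.

module Submission where

open import Defs
open import Data.Bool using (Bool; true; false; if_then_else_; T; _∧_)
open import Data.Bool.Properties using (T-∧)
open import Data.Empty using (⊥; ⊥-elim)
open import Data.Fin using (Fin; zero; suc)
open import Data.List using (List; []; _∷_; _++_; map; length; _ʳ++_)
open import Data.List.Properties using (++-assoc; ++-identityʳ; length-map; reverse-involutive)
open import Data.List.Membership.Propositional using (_∈_)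
open import Data.List.Relation.Binary.Permutation.Propositional
  using (_↭_; ↭-refl; ↭-sym; ↭-trans; ↭-prep; ↭-swap; ↭-reflexive)
open import Data.List.Relation.Binary.Permutation.Propositional.Properties
  using (∷↭∷ʳ; shifts) renaming (++-comm to ↭-++-comm)
open import Data.List.Relation.Binary.Subset.Propositional using (_⊆_)
open import Data.List.Relation.Binary.Subset.Propositional.Properties
  using (⊆-refl; ⊆-trans; ⊆-reflexive-↭; ∷⁺ʳ; ∈-∷⁺ʳ; xs⊆x∷xs; xs⊆xs++ys; xs⊆ys++xs; ++⁺; map⁺)
open import Data.List.Relation.Unary.AllPairs using ([])
open import Data.List.Relation.Unary.Any using (here; there)
open import Data.Maybe using (Maybe; just; nothing; from-just)
open import Data.Nat using (ℕ; zero; suc; _+_; _*_; _^_; _≤_; _∸_; _≡ᵇ_; _<ᵇ_; z≤n; s≤s; _≟_)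
open import Data.List.Relation.Unary.Unique.DecPropositional _≟_ using (unique?)
open import Data.Nat.GeneralisedArithmetic using (fold; fold-+; iterate; iterate-is-fold)
open import Data.Nat.Properties
  using (≡ᵇ⇒≡; ≡⇒≡ᵇ; <ᵇ⇒<; <⇒<ᵇ; <-≤-trans; ≤-refl; ≤-reflexive; ≤-trans; m≤n⇒m≤1+n; n≤1+n; +-suc; +-comm; m≤m+n; m≤n+m;
         +-mono-≤; +-monoˡ-≤; *-comm; *-assoc; *-monoʳ-≤; m∸n+n≡m; *-identityʳ; module ≤-Reasoning)
open import Data.Nat.Solver using (module +-*-Solver)
open import Data.Product using (Σ; _×_; _,_; proj₁; proj₂)
open import Data.Sum using (inj₁; inj₂)
open import Data.Unit using (⊤; tt)
open import Function.Base using (_∘_)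
open import Function.Bundles using (Equivalence)
open import Relation.Binary.Construct.Closure.ReflexiveTransitive using (ε; _◅_; _◅◅_; gmap)
open import Relation.Binary.PropositionalEquality
  using (_≡_; _≢_; refl; sym; trans; cong; cong₂; module ≡-Reasoning) renaming (subst to transport)
open import Relation.Nullary using (¬_; ¬?)
open import Relation.Nullary.Decidable using (dec⇒maybe)

-- A checker for typing derivations

ty-eq? : (A B : Ty) → Maybe (A ≡ B)
ty-eq? (tv n) (tv m) with dec⇒maybe (n ≟ m)
... | just refl = just refl
... | nothing = nothing
ty-eq? (all A) (all B) with ty-eq? A B
... | just refl = just refl
... | nothing = nothing
ty-eq? (mu A) (mu B) with ty-eq? A B
... | just refl = just refl
... | nothing = nothing
ty-eq? (A ⊸ B) (A' ⊸ B') with ty-eq? A A' | ty-eq? B B'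
... | just refl | just refl = just refl
... | _ | _ = nothing
ty-eq? (A ⇒ B) (A' ⇒ B') with ty-eq? A A' | ty-eq? B B'
... | just refl | just refl = just refl
... | _ | _ = nothing
ty-eq? _ _ = nothing

decl-eq? : (a b : ℕ × Ty) → Maybe (a ≡ b)
decl-eq? (x , A) (y , B) with dec⇒maybe (x ≟ y) | ty-eq? A B
... | just refl | just refl = just refl
... | _ | _ = nothing

mutual
  pos? : ∀ n A → Maybe (Pos n A)
  pos? n (tv m) = just tt
  pos? n (all A) = pos? (suc n) A
  pos? n (mu A) = pos? (suc n) A
  pos? n (A ⊸ B) with neg? n A | pos? n B
  ... | just a | just b = just (a , b)
  ... | _ | _ = nothing
  pos? n (A ⇒ B) with neg? n A | pos? n B
  ... | just a | just b = just (a , b)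
  ... | _ | _ = nothing

  neg? : ∀ n A → Maybe (Neg n A)
  neg? n (tv m) = dec⇒maybe (¬? (m ≟ n))
  neg? n (all A) = neg? (suc n) A
  neg? n (mu A) = neg? (suc n) A
  neg? n (A ⊸ B) with pos? n A | neg? n B
  ... | just a | just b = just (a , b)
  ... | _ | _ = nothing
  neg? n (A ⇒ B) with pos? n A | neg? n B
  ... | just a | just b = just (a , b)
  ... | _ | _ = nothing

lin? : ∀ A → Maybe (Lin A)
lin? (tv n) = just (tv n)
lin? (all A) with lin? A
... | just l = just (all l)
... | nothing = nothing
lin? (mu A) with lin? A | pos? zero A
... | just l | just p = just (mu l p)
... | _ | _ = nothing
lin? (A ⊸ B) with lin? A | lin? B
... | just a | just b = just (a ⊸ b)
... | _ | _ = nothing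
lin? (A ⇒ B) = nothing

fm? : ∀ A → Maybe (Fm A)
fm? A with lin? A
fm? A | just l = just (lin l)
fm? (all A) | nothing with fm? A
... | just f = just (all f)
... | nothing = nothing
fm? (A ⊸ B) | nothing with lin? A | fm? B
... | just a | just b = just (a ⊸ b)
... | _ | _ = nothing
fm? (A ⇒ B) | nothing with fm? A | fm? B
... | just a | just b = just (a ⇒ b)
... | _ | _ = nothing
fm? _ | nothing = nothing

distinct? : (Γ Δ : Ctx) → Maybe (Distinct Γ Δ)
distinct? Γ Δ = dec⇒maybe (unique? (dom Γ ++ dom Δ))

select? : (a : ℕ × Ty) (Γ : Ctx) → Maybe (Σ Ctx λ Γ' → Γ ↭ a ∷ Γ')
select? a [] = nothing
select? a (b ∷ Γ) with decl-eq? b a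
... | just refl = just (Γ , ↭-refl)
... | nothing with select? a Γ
...   | just (Γ' , p) = just (b ∷ Γ' , ↭-trans (↭-prep b p) (↭-swap b a ↭-refl))
...   | nothing = nothing

↭? : (Γ Γ' : Ctx) → Maybe (Γ ↭ Γ')
↭? [] [] = just ↭-refl
↭? (a ∷ Γ) Γ' with select? a Γ'
... | nothing = nothing
... | just (Γ'' , p) with ↭? Γ Γ''
...   | just q = just (↭-trans (↭-prep a q) (↭-sym p))
...   | nothing = nothing
↭? _ _ = nothing

∧-elim : ∀ {a b} → T (a ∧ b) → T a × T b
∧-elim = Equivalence.to T-∧

∧-intro : ∀ {a b} → T a → T b → T (a ∧ b)
∧-intro p q = Equivalence.from T-∧ (p , q)

Fixes : (ℕ → ℕ) → ℕ → Set
Fixes ρ n = ∀ i → T (i <ᵇ n) → ρ i ≡ i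

ext-fixes : ∀ {ρ n} → Fixes ρ n → Fixes (ext ρ) (suc n)
ext-fixes h zero _ = refl
ext-fixes h (suc i) p = cong suc (h i p)

ClosedTyᵇ : ℕ → Ty → Bool
ClosedTyᵇ n (tv m) = m <ᵇ n
ClosedTyᵇ n (all A) = ClosedTyᵇ (suc n) A
ClosedTyᵇ n (mu A) = ClosedTyᵇ (suc n) A
ClosedTyᵇ n (A ⊸ B) = ClosedTyᵇ n A ∧ ClosedTyᵇ n B
ClosedTyᵇ n (A ⇒ B) = ClosedTyᵇ n A ∧ ClosedTyᵇ n B

renTy-closed : ∀ {n ρ} A → Fixes ρ n → T (ClosedTyᵇ n A) → renTy ρ A ≡ A
renTy-closed (tv m) h c = cong tv (h m c)
renTy-closed (all A) h c = cong all (renTy-closed A (ext-fixes h) c)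
renTy-closed (mu A) h c = cong mu (renTy-closed A (ext-fixes h) c)
renTy-closed (A ⊸ B) h c = cong₂ _⊸_ (renTy-closed A h (proj₁ (∧-elim c))) (renTy-closed B h (proj₂ (∧-elim c)))
renTy-closed (A ⇒ B) h c = cong₂ _⇒_ (renTy-closed A h (proj₁ (∧-elim c))) (renTy-closed B h (proj₂ (∧-elim c)))

shiftCtx-closed? : (Γ : Ctx) → Maybe (shiftCtx Γ ≡ Γ)
shiftCtx-closed? [] = just refl
shiftCtx-closed? ((x , A) ∷ Γ) with ClosedTyᵇ 0 A in eq | shiftCtx-closed? Γ
... | true | just e = just (cong₂ _∷_ (cong (x ,_) (renTy-closed A (λ _ ()) (transport T (sym eq) tt))) e)
... | _ | _ = nothing

-- Terms from which a derivation can be computed; `closed` lets derivations of families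
-- of terms (numerals, dispatchers, iterators below) be assembled by recursion.
data ATm : Set where
  v : ℕ → ATm
  lam⊸ lam⇒ : ℕ → Ty → ATm → ATm
  _⊸·_ _⇒·_ : ATm → ATm → ATm
  inst : ATm → Ty → ATm
  gen : ATm → ATm
  roll : Ty → ATm → ATm
  unroll : ATm → ATm
  closed : (t : Tm) (A : Ty) → [] ⨾ [] ⊢ t ∶ A → ATm

infixl 7 _⊸·_ _⇒·_

erase : ATm → Tm
erase (v x) = var x
erase (lam⊸ x _ t) = lam x (erase t)
erase (lam⇒ x _ t) = lam x (erase t)
erase (t ⊸· u) = app (erase t) (erase u)
erase (t ⇒· u) = app (erase t) (erase u)
erase (inst t _) = erase t
erase (gen t) = erase t
erase (roll _ t) = erase t
erase (unroll t) = erase t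
erase (closed t _ _) = t

data Mode : Set where
  linear unrestricted : Mode

Env : Set
Env = List (ℕ × Ty × Mode)

lookupEnv : ℕ → Env → Maybe (Ty × Mode)
lookupEnv x [] = nothing
lookupEnv x ((y , A , m) ∷ e) = if y ≡ᵇ x then just (A , m) else lookupEnv x e

Derivation : Tm → Set
Derivation t = Σ Ctx λ Γ → Σ Ctx λ Δ → Σ Ty λ A → Γ ⨾ Δ ⊢ t ∶ A

bind-linear : ∀ {Γ Δ t B} z A → Γ ⨾ Δ ⊢ t ∶ B →
  Maybe (Σ Ctx λ Δ' → Γ ⨾ (Δ' ++ (z , A) ∷ []) ⊢ t ∶ B)
bind-linear {Γ} {Δ} z A d with select? (z , A) Δ
... | just (Δ' , p) = just (Δ' , exch ↭-refl (↭-trans p (∷↭∷ʳ (z , A) Δ')) d)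
... | nothing with lin? A | distinct? (Γ ++ []) (Δ ++ (z , A) ∷ [])
...   | just l | just ds =
          just (Δ , exch (↭-reflexive (++-identityʳ Γ)) ↭-refl (weak {Γ' = []} tt (l , tt) ds d))
...   | _ | _ = nothing

bind-unrestricted : ∀ {Γ Δ t B} z A → Γ ⨾ Δ ⊢ t ∶ B →
  Maybe (Σ Ctx λ Γ' → (Γ' ++ (z , A) ∷ []) ⨾ Δ ⊢ t ∶ B)
bind-unrestricted {Γ} {Δ} z A d with select? (z , A) Γ
... | just (Γ' , p) = just (Γ' , exch (↭-trans p (∷↭∷ʳ (z , A) Γ')) ↭-refl d)
... | nothing with fm? A | distinct? (Γ ++ (z , A) ∷ []) (Δ ++ [])
...   | just f | just ds =
          just (Γ , exch ↭-refl (↭-reflexive (++-identityʳ Δ)) (weak {Δ' = []} (f , tt) tt ds d))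
...   | _ | _ = nothing

generalise : ∀ {Γ Δ t A} → shiftCtx Γ ≡ Γ → shiftCtx Δ ≡ Δ → Γ ⨾ Δ ⊢ t ∶ A → Γ ⨾ Δ ⊢ t ∶ all A
generalise {Γ} {Δ} {t} {A} p q d = ∀ᵢ (transport (λ Θ → Θ ⨾ shiftCtx Δ ⊢ t ∶ A) (sym p)
  (transport (λ Θ → Γ ⨾ Θ ⊢ t ∶ A) (sym q) d))

check : Env → (a : ATm) → Maybe (Derivation (erase a))
check e (v x) with lookupEnv x e
... | nothing = nothing
... | just (A , linear) with lin? A
...   | just l = just ([] , (x , A) ∷ [] , A , ax2 l)
...   | nothing = nothing
check e (v x) | just (A , unrestricted) with fm? A
...   | just f = just ((x , A) ∷ [] , [] , A , ax1 f)
...   | nothing = nothing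
check e (lam⊸ z A a) with check ((z , A , linear) ∷ e) a
... | nothing = nothing
... | just (Γ , Δ , B , d) with bind-linear z A d
...   | just (Δ' , d') = just (Γ , Δ' , A ⊸ B , ⊸ᵢ d')
...   | nothing = nothing
check e (lam⇒ z A a) with check ((z , A , unrestricted) ∷ e) a
... | nothing = nothing
... | just (Γ , Δ , B , d) with bind-unrestricted z A d
...   | just (Γ' , d') = just (Γ' , Δ , A ⇒ B , ⇒ᵢ d')
...   | nothing = nothing
check e (a ⊸· b) with check e a | check e b
... | just (Γ₁ , Δ₁ , (L ⊸ B) , d₁) | just (Γ₂ , Δ₂ , A , d₂) with ty-eq? A L | distinct? (Γ₁ ++ Γ₂) (Δ₁ ++ Δ₂)
...   | just refl | just ds = just (Γ₁ ++ Γ₂ , Δ₁ ++ Δ₂ , B , ⊸ₑ ds d₁ d₂)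
...   | _ | _ = nothing
check e (a ⊸· b) | _ | _ = nothing
check e (a ⇒· b) with check e a | check e b
... | just (Γ₁ , Δ₁ , (A' ⇒ B) , d₁) | just (Γ₂ , [] , A , d₂) with ty-eq? A A' | distinct? (Γ₁ ++ Γ₂) Δ₁
...   | just refl | just ds = just (Γ₁ ++ Γ₂ , Δ₁ , B , ⇒ₑ ds d₁ d₂)
...   | _ | _ = nothing
check e (a ⇒· b) | _ | _ = nothing
check e (inst a L) with check e a | lin? L
... | just (Γ , Δ , all A , d) | just l = just (Γ , Δ , A [ L ]ᵗ , ∀ₑ l d)
... | _ | _ = nothing
check e (gen a) with check e a
... | nothing = nothing
... | just (Γ , Δ , A , d) with shiftCtx-closed? Γ | shiftCtx-closed? Δ
...   | just p | just q = just (Γ , Δ , all A , generalise p q d)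
...   | _ | _ = nothing
check e (roll (mu L) a) with check e a | lin? (mu L)
... | just (Γ , Δ , A , d) | just l with ty-eq? A (L [ mu L ]ᵗ)
...   | just refl = just (Γ , Δ , mu L , μᵢ l d)
...   | nothing = nothing
check e (roll (mu L) a) | _ | _ = nothing
check e (roll _ a) = nothing
check e (unroll a) with check e a
... | just (Γ , Δ , mu A , d) = just (Γ , Δ , A [ mu A ]ᵗ , μₑ d)
... | _ = nothing
check e (closed t A d) = just ([] , [] , A , d)

typed : (a : ATm) (A : Ty) → Maybe ([] ⨾ [] ⊢ erase a ∶ A)
typed a A with check [] a
... | just ([] , [] , B , d) with ty-eq? B A
...   | just refl = just d
...   | nothing = nothing
typed a A | _ = nothing

not-bound? : (z : ℕ) (t : Tm) → Maybe (¬ BoundIn z t)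
not-bound? z (var x) = just λ ()
not-bound? z (lam y t) with dec⇒maybe (¬? (z ≟ y)) | not-bound? z t
... | just p | just q = just λ { (inj₁ r) → p r ; (inj₂ r) → q r }
... | _ | _ = nothing
not-bound? z (app t u) with not-bound? z t | not-bound? z u
... | just p | just q = just λ { (inj₁ r) → p r ; (inj₂ r) → q r }
... | _ | _ = nothing

contract? : ∀ {Γ Δ t B} (Γ₀ : Ctx) (x y z : ℕ) (A : Ty) → Maybe (Γ ⨾ Δ ⊢ t ∶ B) →
  Maybe ((Γ₀ ++ (z , A) ∷ []) ⨾ Δ ⊢ ren y z (ren x z t) ∶ B)
contract? {Γ} {Δ} {t} Γ₀ x y z A (just d)
  with ↭? Γ (Γ₀ ++ (x , A) ∷ (y , A) ∷ []) | distinct? (Γ₀ ++ (z , A) ∷ []) Δ | not-bound? z t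
... | just p | just ds | just nb = just (contr ds nb (exch p ↭-refl d))
... | _ | _ | _ = nothing
contract? _ _ _ _ _ nothing = nothing

check-in? : Env → (a : ATm) → (Γ Δ : Ctx) (B : Ty) → Maybe (Γ ⨾ Δ ⊢ erase a ∶ B)
check-in? e a Γ Δ B with check e a
... | nothing = nothing
... | just (Γ₁ , Δ₁ , B₁ , d) with ty-eq? B₁ B | ↭? Γ₁ Γ | ↭? Δ₁ Δ
...   | just refl | just p | just q = just (exch p q d)
...   | _ | _ | _ = nothing

Scoped : List ℕ → Tm → Set
Scoped s (var x) = x ∈ s
Scoped s (lam x t) = Scoped (x ∷ s) t
Scoped s (app t u) = Scoped s t × Scoped s u

Scoped-mono : ∀ {s s'} t → s ⊆ s' → Scoped s t → Scoped s' t
Scoped-mono (var x) h p = h p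
Scoped-mono (lam x t) h p = Scoped-mono t (∷⁺ʳ x h) p
Scoped-mono (app t u) h (p , q) = Scoped-mono t h p , Scoped-mono u h q

≡ᵇ-true⇒≡ : ∀ {m n} → (m ≡ᵇ n) ≡ true → m ≡ n
≡ᵇ-true⇒≡ {m} {n} e = ≡ᵇ⇒≡ m n (transport T (sym e) tt)

≡ᵇ-false⇒≢ : ∀ {m n} → (m ≡ᵇ n) ≡ false → m ≢ n
≡ᵇ-false⇒≢ {m} {n} e p = transport T e (≡⇒≡ᵇ m n p)

Scoped-ren : ∀ {s} x z t → z ∈ s → Scoped (x ∷ s) t → Scoped s (ren x z t)
Scoped-ren x z (var y) z∈s p with y ≡ᵇ x in e
... | true = z∈s
... | false with p
...   | here y≡x = ⊥-elim (≡ᵇ-false⇒≢ e y≡x)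
...   | there y∈s = y∈s
Scoped-ren x z (lam y t) z∈s p with y ≡ᵇ x in e
... | true = Scoped-mono t (absorb (≡ᵇ-true⇒≡ e)) p
  where
  absorb : ∀ {s} → y ≡ x → y ∷ x ∷ s ⊆ y ∷ s
  absorb refl = ∈-∷⁺ʳ (here refl) ⊆-refl
... | false = Scoped-ren x z t (there z∈s) (Scoped-mono t (⊆-reflexive-↭ (↭-swap y x ↭-refl)) p)
Scoped-ren x z (app t u) z∈s (p , q) = Scoped-ren x z t z∈s p , Scoped-ren x z u z∈s q

dom⁺ : ∀ {Γ Γ'} → Γ ⊆ Γ' → dom Γ ⊆ dom Γ'
dom⁺ = map⁺ proj₁

dom-shiftCtx-++ : ∀ Γ Δ → dom (shiftCtx Γ ++ shiftCtx Δ) ≡ dom (Γ ++ Δ)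
dom-shiftCtx-++ [] [] = refl
dom-shiftCtx-++ [] ((x , _) ∷ Δ) = cong (x ∷_) (dom-shiftCtx-++ [] Δ)
dom-shiftCtx-++ ((x , _) ∷ Γ) Δ = cong (x ∷_) (dom-shiftCtx-++ Γ Δ)

moveˡ : ∀ (Γ Θ Δ : Ctx) → (Γ ++ Θ) ++ Δ ↭ Θ ++ Γ ++ Δ
moveˡ Γ Θ Δ = ↭-trans (↭-reflexive (++-assoc Γ Θ Δ)) (shifts Γ Θ)

moveʳ : ∀ (Γ Δ Θ : Ctx) → Γ ++ Δ ++ Θ ↭ Θ ++ Γ ++ Δ
moveʳ Γ Δ Θ = ↭-trans (↭-reflexive (sym (++-assoc Γ Δ Θ))) (↭-++-comm (Γ ++ Δ) Θ)

⊢-scoped : ∀ {Γ Δ t A} → Γ ⨾ Δ ⊢ t ∶ A → Scoped (dom (Γ ++ Δ)) t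
⊢-scoped (ax1 _) = here refl
⊢-scoped (ax2 _) = here refl
⊢-scoped (μₑ d) = ⊢-scoped d
⊢-scoped (μᵢ _ d) = ⊢-scoped d
⊢-scoped (∀ᵢ {Γ} {Δ} {t} d) = transport (λ s → Scoped s t) (dom-shiftCtx-++ Γ Δ) (⊢-scoped d)
⊢-scoped (∀ₑ _ d) = ⊢-scoped d
⊢-scoped (⇒ₑ {Γ₁} {Γ₂} {Δ} {t} {u} _ d e) =
  Scoped-mono t (dom⁺ (++⁺ (xs⊆xs++ys Γ₁ Γ₂) ⊆-refl)) (⊢-scoped d) ,
  Scoped-mono u (dom⁺ (++⁺ (xs⊆ys++xs Γ₂ Γ₁) λ ())) (⊢-scoped e)
⊢-scoped (⇒ᵢ {Γ} {Δ} {z} {t} {A} d) =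
  Scoped-mono t (dom⁺ (⊆-reflexive-↭ (moveˡ Γ ((z , A) ∷ []) Δ))) (⊢-scoped d)
⊢-scoped (⊸ₑ {Γ₁} {Γ₂} {Δ₁} {Δ₂} {t} {u} _ d e) =
  Scoped-mono t (dom⁺ (++⁺ (xs⊆xs++ys Γ₁ Γ₂) (xs⊆xs++ys Δ₁ Δ₂))) (⊢-scoped d) ,
  Scoped-mono u (dom⁺ (++⁺ (xs⊆ys++xs Γ₂ Γ₁) (xs⊆ys++xs Δ₂ Δ₁))) (⊢-scoped e)
⊢-scoped (⊸ᵢ {Γ} {Δ} {z} {t} {L} d) =
  Scoped-mono t (dom⁺ (⊆-reflexive-↭ (moveʳ Γ Δ ((z , L) ∷ [])))) (⊢-scoped d)
⊢-scoped (contr {Γ} {Δ} {x} {y} {z} {t} {A} _ _ d) =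
  Scoped-ren y z (ren x z t) z∈Θ
    (Scoped-ren x z t (there z∈Θ)
      (Scoped-mono t (⊆-trans (dom⁺ (⊆-reflexive-↭ (moveˡ Γ ((x , A) ∷ (y , A) ∷ []) Δ)))
                              (∷⁺ʳ x (∷⁺ʳ y (⊆-trans (xs⊆x∷xs _ z) Γ,Δ⊆Θ))))
        (⊢-scoped d)))
  where
  Γ,Δ⊆Θ : z ∷ dom (Γ ++ Δ) ⊆ dom ((Γ ++ (z , A) ∷ []) ++ Δ)
  Γ,Δ⊆Θ = dom⁺ (⊆-reflexive-↭ (↭-sym (moveˡ Γ ((z , A) ∷ []) Δ)))
  z∈Θ : z ∈ dom ((Γ ++ (z , A) ∷ []) ++ Δ)
  z∈Θ = Γ,Δ⊆Θ (here refl)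
⊢-scoped (derel {Γ} {Δ} {x} {t} {L} d) =
  Scoped-mono t (dom⁺ (⊆-reflexive-↭ (↭-trans (moveʳ Γ Δ ((x , L) ∷ [])) (↭-sym (moveˡ Γ ((x , L) ∷ []) Δ)))))
    (⊢-scoped d)
⊢-scoped (weak {Γ} {Γ'} {Δ} {Δ'} {t} _ _ _ d) =
  Scoped-mono t (dom⁺ (++⁺ (xs⊆xs++ys Γ Γ') (xs⊆xs++ys Δ Δ'))) (⊢-scoped d)
⊢-scoped (exch {t = t} p q d) = Scoped-mono t (dom⁺ (++⁺ (⊆-reflexive-↭ p) (⊆-reflexive-↭ q))) (⊢-scoped d)

closedᵇ : ℕ → Λ → Bool
closedᵇ n (` i) = i <ᵇ n
closedᵇ n (ƛ t) = closedᵇ (suc n) t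
closedᵇ n (t · u) = closedᵇ n t ∧ closedᵇ n u

Closed : ℕ → Λ → Set
Closed n t = T (closedᵇ n t)

Closed-≤ : ∀ {m n} t → m ≤ n → Closed m t → Closed n t
Closed-≤ {m} {n} (` i) m≤n p = <⇒<ᵇ (<-≤-trans (<ᵇ⇒< i m p) m≤n)
Closed-≤ (ƛ t) m≤n p = Closed-≤ t (s≤s m≤n) p
Closed-≤ (t · u) m≤n p = ∧-intro (Closed-≤ t m≤n (proj₁ (∧-elim p))) (Closed-≤ u m≤n (proj₂ (∧-elim p)))

idx-++ : ∀ s e x → x ∈ s → idx (s ++ e) x ≡ idx s x
idx-++ (y ∷ s) e x p with y ≡ᵇ x in eq
... | true = refl
... | false with p
...   | here x≡y = ⊥-elim (≡ᵇ-false⇒≢ eq (sym x≡y))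
...   | there x∈s = cong suc (idx-++ s e x x∈s)

idx-< : ∀ s x → x ∈ s → T (idx s x <ᵇ length s)
idx-< (y ∷ s) x p with y ≡ᵇ x in eq
... | true = tt
... | false with p
...   | here x≡y = ⊥-elim (≡ᵇ-false⇒≢ eq (sym x≡y))
...   | there x∈s = idx-< s x x∈s

toDB-++ : ∀ s e t → Scoped s t → toDB (s ++ e) t ≡ toDB s t
toDB-++ s e (var x) p = cong ` (idx-++ s e x p)
toDB-++ s e (lam x t) p = cong ƛ (toDB-++ (x ∷ s) e t p)
toDB-++ s e (app t u) (p , q) = cong₂ _·_ (toDB-++ s e t p) (toDB-++ s e u q)

toDB-Closed : ∀ s t → Scoped s t → Closed (length s) (toDB s t)
toDB-Closed s (var x) p = idx-< s x p
toDB-Closed s (lam x t) p = toDB-Closed (x ∷ s) t p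
toDB-Closed s (app t u) (p , q) = ∧-intro (toDB-Closed s t p) (toDB-Closed s u q)

db : Tm → Λ
db = toDB []

toDB-closed : ∀ e t → Scoped [] t → toDB e t ≡ db t
toDB-closed e = toDB-++ [] e

⊢-Closed : ∀ {t A} → [] ⨾ [] ⊢ t ∶ A → Closed 0 (db t)
⊢-Closed {t} d = toDB-Closed [] t (⊢-scoped d)

rename-closed : ∀ {n ρ} t → Fixes ρ n → Closed n t → rename ρ t ≡ t
rename-closed (` i) h c = cong ` (h i c)
rename-closed (ƛ t) h c = cong ƛ (rename-closed t (ext-fixes h) c)
rename-closed (t · u) h c = cong₂ _·_ (rename-closed t h (proj₁ (∧-elim c))) (rename-closed u h (proj₂ (∧-elim c)))

FixesΛ : (ℕ → Λ) → ℕ → Set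
FixesΛ σ n = ∀ i → T (i <ᵇ n) → σ i ≡ ` i

exts-fixes : ∀ {σ n} → FixesΛ σ n → FixesΛ (exts σ) (suc n)
exts-fixes h zero _ = refl
exts-fixes h (suc i) p = cong (rename suc) (h i p)

subst-closed : ∀ {n σ} t → FixesΛ σ n → Closed n t → subst σ t ≡ t
subst-closed (` i) h c = h i c
subst-closed (ƛ t) h c = cong ƛ (subst-closed t (exts-fixes h) c)
subst-closed (t · u) h c = cong₂ _·_ (subst-closed t h (proj₁ (∧-elim c))) (subst-closed u h (proj₂ (∧-elim c)))

subst-cong : ∀ t {σ τ : ℕ → Λ} → (∀ i → σ i ≡ τ i) → subst σ t ≡ subst τ t
subst-cong (` i) h = h i
subst-cong (ƛ t) {σ} {τ} h = cong ƛ (subst-cong t h')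
  where
  h' : ∀ i → exts σ i ≡ exts τ i
  h' zero = refl
  h' (suc i) = cong (rename suc) (h i)
subst-cong (t · u) h = cong₂ _·_ (subst-cong t h) (subst-cong u h)

recover : ∀ b → .(T b) → T b
recover true _ = tt

-- The closedness proof is irrelevant, so constants are equal as soon as their terms are.
data MTm : Set where
  mv : ℕ → MTm
  mƛ : MTm → MTm
  _m·_ : MTm → MTm → MTm
  const : (t : Λ) → .(Closed 0 t) → MTm

infixl 7 _m·_

⌊_⌋ : MTm → Λ
⌊ mv i ⌋ = ` i
⌊ mƛ m ⌋ = ƛ ⌊ m ⌋
⌊ m m· n ⌋ = ⌊ m ⌋ · ⌊ n ⌋
⌊ const t _ ⌋ = t

mren : (ℕ → ℕ) → MTm → MTm
mren ρ (mv i) = mv (ρ i)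
mren ρ (mƛ m) = mƛ (mren (ext ρ) m)
mren ρ (m m· n) = mren ρ m m· mren ρ n
mren ρ (const t p) = const t p

mexts : (ℕ → MTm) → ℕ → MTm
mexts σ zero = mv zero
mexts σ (suc n) = mren suc (σ n)

msub : (ℕ → MTm) → MTm → MTm
msub σ (mv i) = σ i
msub σ (mƛ m) = mƛ (msub (mexts σ) m)
msub σ (m m· n) = msub σ m m· msub σ n
msub σ (const t p) = const t p

msingle : MTm → ℕ → MTm
msingle u zero = u
msingle u (suc n) = mv n

⌊mren⌋ : ∀ ρ m → ⌊ mren ρ m ⌋ ≡ rename ρ ⌊ m ⌋
⌊mren⌋ ρ (mv i) = refl
⌊mren⌋ ρ (mƛ m) = cong ƛ (⌊mren⌋ (ext ρ) m)
⌊mren⌋ ρ (m m· n) = cong₂ _·_ (⌊mren⌋ ρ m) (⌊mren⌋ ρ n)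
⌊mren⌋ ρ (const t p) = sym (rename-closed t (λ _ ()) (recover (closedᵇ 0 t) p))

⌊msub⌋ : ∀ σ m → ⌊ msub σ m ⌋ ≡ subst (λ i → ⌊ σ i ⌋) ⌊ m ⌋
⌊msub⌋ σ (mv i) = refl
⌊msub⌋ σ (mƛ m) = cong ƛ (trans (⌊msub⌋ (mexts σ) m) (subst-cong ⌊ m ⌋ h))
  where
  h : ∀ i → ⌊ mexts σ i ⌋ ≡ exts (λ j → ⌊ σ j ⌋) i
  h zero = refl
  h (suc i) = ⌊mren⌋ suc (σ i)
⌊msub⌋ σ (m m· n) = cong₂ _·_ (⌊msub⌋ σ m) (⌊msub⌋ σ n)
⌊msub⌋ σ (const t p) = sym (subst-closed t (λ _ ()) (recover (closedᵇ 0 t) p))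

-- A record, so that both endpoints can be inferred from the type.
record _⟶ₘ_ (a b : MTm) : Set where
  constructor mk
  field reduces : ⌊ a ⌋ ⟶β* ⌊ b ⌋
open _⟶ₘ_ public
infix 2 _⟶ₘ_

βₘ : ∀ m u → mƛ m m· u ⟶ₘ msub (msingle u) m
βₘ m u = mk (transport (λ r → (ƛ ⌊ m ⌋ · ⌊ u ⌋) ⟶β* r) eq (β ◅ ε))
  where
  eq : ⌊ m ⌋ [ ⌊ u ⌋ ] ≡ ⌊ msub (msingle u) m ⌋
  eq = trans (subst-cong ⌊ m ⌋ λ { zero → refl ; (suc i) → refl }) (sym (⌊msub⌋ (msingle u) m))

_▹_ : ∀ {a b c} → a ⟶ₘ b → b ⟶ₘ c → a ⟶ₘ c
mk p ▹ mk q = mk (p ◅◅ q)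
infixr 5 _▹_

⟶ₘ-refl : ∀ {a} → a ⟶ₘ a
⟶ₘ-refl = mk ε

⟶ₘ-reflexive : ∀ {a b} → ⌊ a ⌋ ≡ ⌊ b ⌋ → a ⟶ₘ b
⟶ₘ-reflexive {a} e = mk (transport (λ x → ⌊ a ⌋ ⟶β* x) e ε)

appˡ : ∀ {a a' b} → a ⟶ₘ a' → a m· b ⟶ₘ a' m· b
appˡ (mk p) = mk (gmap _ ξₗ p)

appʳ : ∀ {a b b'} → b ⟶ₘ b' → a m· b ⟶ₘ a m· b'
appʳ (mk p) = mk (gmap _ ξᵣ p)

appˡ² : ∀ {a a' b c} → a ⟶ₘ a' → a m· b m· c ⟶ₘ a' m· b m· c
appˡ² p = appˡ (appˡ p)

appˡ³ : ∀ {a a' b c d} → a ⟶ₘ a' → a m· b m· c m· d ⟶ₘ a' m· b m· c m· d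
appˡ³ p = appˡ (appˡ² p)

appˡ⁴ : ∀ {a a' b c d e} → a ⟶ₘ a' → a m· b m· c m· d m· e ⟶ₘ a' m· b m· c m· d m· e
appˡ⁴ p = appˡ (appˡ³ p)

head-step : MTm → Maybe MTm
head-step (mƛ b m· u) = just (msub (msingle u) b)
head-step (a m· b) with head-step a
... | just a' = just (a' m· b)
... | nothing = nothing
head-step _ = nothing

HeadStep : MTm → Maybe MTm → Set
HeadStep m nothing = ⊤
HeadStep m (just m') = m ⟶ₘ m'

head-step-sound : ∀ m → HeadStep m (head-step m)
head-step-sound (mv x) = tt
head-step-sound (mƛ m) = tt
head-step-sound (const t x) = tt
head-step-sound (mƛ b m· u) = βₘ b u
head-step-sound (mv x m· b) = tt
head-step-sound (const t x m· b) = tt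
head-step-sound ((a m· a₁) m· b) with head-step (a m· a₁) | head-step-sound (a m· a₁)
... | just a' | p = appˡ p
... | nothing | _ = tt

head-normalise : ℕ → MTm → MTm
head-normalise zero m = m
head-normalise (suc n) m with head-step m
... | just m' = head-normalise n m'
... | nothing = m

⟶ₘ-head-normalise : ∀ n m → m ⟶ₘ head-normalise n m
⟶ₘ-head-normalise zero m = ⟶ₘ-refl
⟶ₘ-head-normalise (suc n) m with head-step m | head-step-sound m
... | just m' | p = p ▹ ⟶ₘ-head-normalise n m'
... | nothing | _ = ⟶ₘ-refl

reduce-by : ∀ n {m} → m ⟶ₘ head-normalise n m
reduce-by n {m} = ⟶ₘ-head-normalise n m

-- Enough fuel for every step of the simulation below.
reduce : ∀ {m} → m ⟶ₘ head-normalise 40 m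
reduce = reduce-by 40

toMTm : List ℕ → ATm → MTm
toMTm e (v x) = mv (idx e x)
toMTm e (lam⊸ x _ a) = mƛ (toMTm (x ∷ e) a)
toMTm e (lam⇒ x _ a) = mƛ (toMTm (x ∷ e) a)
toMTm e (a ⊸· b) = toMTm e a m· toMTm e b
toMTm e (a ⇒· b) = toMTm e a m· toMTm e b
toMTm e (inst a _) = toMTm e a
toMTm e (gen a) = toMTm e a
toMTm e (roll _ a) = toMTm e a
toMTm e (unroll a) = toMTm e a
toMTm e (closed t A d) = const (db t) (⊢-Closed d)

⌊toMTm⌋ : ∀ e a → ⌊ toMTm e a ⌋ ≡ toDB e (erase a)
⌊toMTm⌋ e (v x) = refl
⌊toMTm⌋ e (lam⊸ x _ a) = cong ƛ (⌊toMTm⌋ (x ∷ e) a)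
⌊toMTm⌋ e (lam⇒ x _ a) = cong ƛ (⌊toMTm⌋ (x ∷ e) a)
⌊toMTm⌋ e (a ⊸· b) = cong₂ _·_ (⌊toMTm⌋ e a) (⌊toMTm⌋ e b)
⌊toMTm⌋ e (a ⇒· b) = cong₂ _·_ (⌊toMTm⌋ e a) (⌊toMTm⌋ e b)
⌊toMTm⌋ e (inst a _) = ⌊toMTm⌋ e a
⌊toMTm⌋ e (gen a) = ⌊toMTm⌋ e a
⌊toMTm⌋ e (roll _ a) = ⌊toMTm⌋ e a
⌊toMTm⌋ e (unroll a) = ⌊toMTm⌋ e a
⌊toMTm⌋ e (closed t A d) = sym (toDB-closed e t (⊢-scoped d))

unfold-closed : ∀ (a : ATm) {p} → const (db (erase a)) p ⟶ₘ toMTm [] a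
unfold-closed a = ⟶ₘ-reflexive (sym (⌊toMTm⌋ [] a))

⌞_⌟ : ∀ {t A} → [] ⨾ [] ⊢ t ∶ A → ATm
⌞ d ⌟ = closed _ _ d

⌜_⌝ : ∀ {t A} → [] ⨾ [] ⊢ t ∶ A → MTm
⌜_⌝ {t} d = const (db t) (⊢-Closed d)

unfold : ∀ a {A} (d : [] ⨾ [] ⊢ erase a ∶ A) → ⌜ d ⌝ ⟶ₘ toMTm [] a
unfold a d = ⟶ₘ-reflexive (sym (⌊toMTm⌋ [] a))

-- The encoding of a machine

-- A configuration (state, scanned symbol, left and right half of the tape) is a
-- Church 4-tuple of Scott numerals and Scott lists of numerals; the output phase
-- works on pairs of the bits read so far, as a difference list, and the rest of the tape.
ℕˢ Tape Cfg Out Action : Ty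
ℕˢ = mu (all ((tv 1 ⊸ tv 0) ⊸ tv 0 ⊸ tv 0))
Tape = mu (all ((ℕˢ ⊸ tv 1 ⊸ tv 0) ⊸ tv 0 ⊸ tv 0))
Cfg = all ((ℕˢ ⊸ ℕˢ ⊸ Tape ⊸ Tape ⊸ tv 0) ⊸ tv 0)
Out = all (((WScott ⊸ WScott) ⊸ Tape ⊸ tv 0) ⊸ tv 0)
Action = Tape ⊸ Tape ⊸ Cfg

-- The binders 90–98 must not occur free in the arguments of these term formers.
zeroˢ : ATm
zeroˢ = roll ℕˢ (gen (lam⊸ 90 (ℕˢ ⊸ tv 0) (lam⊸ 91 (tv 0) (v 91))))

sucˢ : ATm → ATm
sucˢ a = roll ℕˢ (gen (lam⊸ 90 (ℕˢ ⊸ tv 0) (lam⊸ 91 (tv 0) (v 90 ⊸· a))))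

nilᵀ : ATm
nilᵀ = roll Tape (gen (lam⊸ 92 (ℕˢ ⊸ Tape ⊸ tv 0) (lam⊸ 93 (tv 0) (v 93))))

consᵀ : ATm → ATm → ATm
consᵀ h t = roll Tape (gen (lam⊸ 92 (ℕˢ ⊸ Tape ⊸ tv 0) (lam⊸ 93 (tv 0) (v 92 ⊸· h ⊸· t))))

cfgA : ATm → ATm → ATm → ATm → ATm
cfgA q a l r = gen (lam⊸ 94 (ℕˢ ⊸ ℕˢ ⊸ Tape ⊸ Tape ⊸ tv 0) (v 94 ⊸· q ⊸· a ⊸· l ⊸· r))

outA : ATm → ATm → ATm
outA acc rest = gen (lam⊸ 95 ((WScott ⊸ WScott) ⊸ Tape ⊸ tv 0) (v 95 ⊸· acc ⊸· rest))

εᵂ : ATm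
εᵂ = roll WScott (gen (lam⊸ 96 (WScott ⊸ tv 0) (lam⊸ 97 (WScott ⊸ tv 0) (lam⊸ 98 (tv 0) (v 98)))))

consᵂ : Bool → ATm → ATm
consᵂ b w = roll WScott (gen (lam⊸ 96 (WScott ⊸ tv 0) (lam⊸ 97 (WScott ⊸ tv 0)
  (lam⊸ 98 (tv 0) (v (if b then 97 else 96) ⊸· w)))))

mutual
  numeral : ∀ {m} → Fin m → Tm
  numeral zero = erase zeroˢ
  numeral (suc i) = erase (sucˢ ⌞ numeral-⊢ i ⌟)

  numeral-⊢ : ∀ {m} (i : Fin m) → [] ⨾ [] ⊢ numeral i ∶ ℕˢ
  numeral-⊢ zero = from-just (typed zeroˢ ℕˢ)
  numeral-⊢ (suc i) = from-just (typed (sucˢ ⌞ numeral-⊢ i ⌟) ℕˢ)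

numeralA : ∀ {m} → Fin m → ATm
numeralA i = ⌞ numeral-⊢ i ⌟

halt-entry : ATm → ATm → ATm
halt-entry q a = lam⊸ 0 Tape (lam⊸ 1 Tape (cfgA q a (v 0) (v 1)))

left-entry : ATm → ATm → ATm
left-entry q a = lam⊸ 0 Tape (lam⊸ 1 Tape (inst (unroll (v 0)) (Tape ⊸ Cfg) ⊸· next ⊸· atEnd ⊸· v 1))
  where
  next atEnd : ATm
  next = lam⊸ 2 ℕˢ (lam⊸ 3 Tape (lam⊸ 4 Tape (cfgA q (v 2) (v 3) (consᵀ a (v 4)))))
  atEnd = lam⊸ 4 Tape (cfgA q zeroˢ nilᵀ (consᵀ a (v 4)))

right-entry : ATm → ATm → ATm
right-entry q a = lam⊸ 0 Tape (lam⊸ 1 Tape (inst (unroll (v 1)) (Tape ⊸ Cfg) ⊸· next ⊸· atEnd ⊸· v 0))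
  where
  next atEnd : ATm
  next = lam⊸ 2 ℕˢ (lam⊸ 3 Tape (lam⊸ 4 Tape (cfgA q (v 2) (consᵀ a (v 4)) (v 3))))
  atEnd = lam⊸ 4 Tape (cfgA q zeroˢ (consᵀ a (v 4)) nilᵀ)

module _ {m₁ m₂ : ℕ} (q : Fin m₁) (a : Fin m₂) where
  halt-entry-⊢ : [] ⨾ [] ⊢ erase (halt-entry (numeralA q) (numeralA a)) ∶ Action
  halt-entry-⊢ = from-just (typed (halt-entry (numeralA q) (numeralA a)) Action)

  left-entry-⊢ : [] ⨾ [] ⊢ erase (left-entry (numeralA q) (numeralA a)) ∶ Action
  left-entry-⊢ = from-just (typed (left-entry (numeralA q) (numeralA a)) Action)

  right-entry-⊢ : [] ⨾ [] ⊢ erase (right-entry (numeralA q) (numeralA a)) ∶ Action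
  right-entry-⊢ = from-just (typed (right-entry (numeralA q) (numeralA a)) Action)

data Cases : Set where
  onSymbol onState : Cases

CaseTy : Cases → Ty
CaseTy onSymbol = Action
CaseTy onState = ℕˢ ⊸ Action

-- Only reached on numerals ≥ m, which do not occur.
default : Cases → ATm
default onSymbol = halt-entry zeroˢ zeroˢ
default onState = lam⊸ 5 ℕˢ (halt-entry zeroˢ zeroˢ)

mutual
  dispatch : ∀ s m {b : Fin m → Tm} → (∀ i → [] ⨾ [] ⊢ b i ∶ CaseTy s) → ATm
  dispatch s zero bd = lam⊸ 0 ℕˢ (default s)
  dispatch s (suc m) bd =
    lam⊸ 0 ℕˢ (inst (unroll (v 0)) (CaseTy s) ⊸· ⌞ dispatch-⊢ s m (bd ∘ suc) ⌟ ⊸· ⌞ bd zero ⌟)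

  dispatch-⊢ : ∀ s m {b : Fin m → Tm} (bd : ∀ i → [] ⨾ [] ⊢ b i ∶ CaseTy s) →
    [] ⨾ [] ⊢ erase (dispatch s m bd) ∶ ℕˢ ⊸ CaseTy s
  dispatch-⊢ onSymbol zero bd = from-just (typed (dispatch onSymbol zero bd) (ℕˢ ⊸ Action))
  dispatch-⊢ onState zero bd = from-just (typed (dispatch onState zero bd) (ℕˢ ⊸ ℕˢ ⊸ Action))
  dispatch-⊢ onSymbol (suc m) bd = from-just (typed (dispatch onSymbol (suc m) bd) (ℕˢ ⊸ Action))
  dispatch-⊢ onState (suc m) bd = from-just (typed (dispatch onState (suc m) bd) (ℕˢ ⊸ ℕˢ ⊸ Action))

data Loop : Set where
  machineLoop outputLoop : Loop

LoopTy : Loop → Ty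
LoopTy machineLoop = Cfg
LoopTy outputLoop = Out

Iterator : Loop → Ty
Iterator s = WChurch ⇒ (LoopTy s ⊸ LoopTy s)

mutual
  power : ∀ s {G} → [] ⨾ [] ⊢ G ∶ LoopTy s ⊸ LoopTy s → ℕ → ATm
  power s gd zero = lam⊸ 0 (LoopTy s) (v 0)
  power s gd (suc m) = lam⊸ 0 (LoopTy s) (⌞ gd ⌟ ⊸· (⌞ power-⊢ s gd m ⌟ ⊸· v 0))

  power-⊢ : ∀ s {G} (gd : [] ⨾ [] ⊢ G ∶ LoopTy s ⊸ LoopTy s) m →
    [] ⨾ [] ⊢ erase (power s gd m) ∶ LoopTy s ⊸ LoopTy s
  power-⊢ machineLoop gd zero = from-just (typed (power machineLoop gd zero) (Cfg ⊸ Cfg))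
  power-⊢ outputLoop gd zero = from-just (typed (power outputLoop gd zero) (Out ⊸ Out))
  power-⊢ machineLoop gd (suc m) = from-just (typed (power machineLoop gd (suc m)) (Cfg ⊸ Cfg))
  power-⊢ outputLoop gd (suc m) = from-just (typed (power outputLoop gd (suc m)) (Out ⊸ Out))

amplifier-body : Tm
amplifier-body = app (app (app (var 1) (app (var 0) (var 1))) (app (var 0) (var 1))) (app (app (var 0) (var 1)) (var 2))

amplifier : Tm
amplifier = lam 0 (lam 1 (lam 2 amplifier-body))

-- The copies of q are named 0, 7, 8 and those of x are named 1, 4, 5, 6 before contraction.
amplifier-body? : (s : Loop) →
  Maybe (((0 , Iterator s) ∷ (1 , WChurch) ∷ []) ⨾ ((2 , LoopTy s) ∷ []) ⊢ amplifier-body ∶ LoopTy s)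
amplifier-body? s =
  contract? ((0 , Q) ∷ []) 1 6 1 WChurch
  (contract? ((0 , Q) ∷ (6 , WChurch) ∷ []) 1 5 1 WChurch
  (contract? ((0 , Q) ∷ (5 , WChurch) ∷ (6 , WChurch) ∷ []) 1 4 1 WChurch
  (contract? ((1 , WChurch) ∷ (4 , WChurch) ∷ (5 , WChurch) ∷ (6 , WChurch) ∷ []) 0 8 0 Q
  (contract? ((8 , Q) ∷ (1 , WChurch) ∷ (4 , WChurch) ∷ (5 , WChurch) ∷ (6 , WChurch) ∷ []) 0 7 0 Q
  (check-in? env body Γ ((2 , LoopTy s) ∷ []) (LoopTy s))))))
  where
  Q : Ty
  Q = Iterator s
  body : ATm
  body = inst (v 1) (LoopTy s) ⇒· (v 0 ⇒· v 4) ⇒· (v 7 ⇒· v 5) ⊸· (v 8 ⇒· v 6 ⊸· v 2)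
  env : Env
  env = (0 , Q , unrestricted) ∷ (7 , Q , unrestricted) ∷ (8 , Q , unrestricted) ∷
        (1 , WChurch , unrestricted) ∷ (4 , WChurch , unrestricted) ∷ (5 , WChurch , unrestricted) ∷
        (6 , WChurch , unrestricted) ∷ (2 , LoopTy s , linear) ∷ []
  Γ : Ctx
  Γ = (0 , Q) ∷ (7 , Q) ∷ (8 , Q) ∷ (1 , WChurch) ∷ (4 , WChurch) ∷ (5 , WChurch) ∷ (6 , WChurch) ∷ []

amplifier-⊢ : (s : Loop) → [] ⨾ [] ⊢ amplifier ∶ Iterator s ⇒ Iterator s
amplifier-⊢ machineLoop = ⇒ᵢ (⇒ᵢ (⊸ᵢ (from-just (amplifier-body? machineLoop))))
amplifier-⊢ outputLoop = ⇒ᵢ (⇒ᵢ (⊸ᵢ (from-just (amplifier-body? outputLoop))))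

iteratorA : ∀ s {G} → [] ⨾ [] ⊢ G ∶ LoopTy s ⊸ LoopTy s → ℕ → ATm
iteratorA s gd m = lam⇒ 1 WChurch ⌞ power-⊢ s gd m ⌟

iterator : ∀ s {G} → [] ⨾ [] ⊢ G ∶ LoopTy s ⊸ LoopTy s → (j m : ℕ) → Tm
iterator s gd zero m = erase (iteratorA s gd m)
iterator s gd (suc j) m = app amplifier (iterator s gd j m)

iterator-⊢ : ∀ s {G} (gd : [] ⨾ [] ⊢ G ∶ LoopTy s ⊸ LoopTy s) j m → [] ⨾ [] ⊢ iterator s gd j m ∶ Iterator s
iterator-⊢ machineLoop gd zero m = from-just (typed (iteratorA machineLoop gd m) (Iterator machineLoop))
iterator-⊢ outputLoop gd zero m = from-just (typed (iteratorA outputLoop gd m) (Iterator outputLoop))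
iterator-⊢ s gd (suc j) m = ⇒ₑ [] (amplifier-⊢ s) (iterator-⊢ s gd j m)

OutStep : Ty
OutStep = (WScott ⊸ WScott) ⊸ Tape ⊸ Out

stop : ATm
stop = lam⊸ 10 (WScott ⊸ WScott) (lam⊸ 11 Tape (outA (v 10) nilᵀ))

emit : Bool → ATm
emit b = lam⊸ 10 (WScott ⊸ WScott) (lam⊸ 11 Tape (outA (lam⊸ 12 WScott (v 10 ⊸· consᵂ b (v 12))) (v 11)))

on-symbol≥2 : ATm
on-symbol≥2 = lam⊸ 7 ℕˢ (inst (unroll (v 7)) OutStep ⊸· lam⊸ 8 ℕˢ stop ⊸· emit true)

on-symbol≥1 : ATm
on-symbol≥1 = lam⊸ 6 ℕˢ (inst (unroll (v 6)) OutStep ⊸· on-symbol≥2 ⊸· emit false)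

on-cell : ATm
on-cell = lam⊸ 3 ℕˢ (lam⊸ 4 Tape (lam⊸ 5 (WScott ⊸ WScott)
  (inst (unroll (v 3)) OutStep ⊸· on-symbol≥1 ⊸· stop ⊸· v 5 ⊸· v 4)))

on-end : ATm
on-end = lam⊸ 5 (WScott ⊸ WScott) (outA (v 5) nilᵀ)

out-step : ATm
out-step = lam⊸ 0 Out (inst (v 0) Out ⊸· lam⊸ 1 (WScott ⊸ WScott) (lam⊸ 2 Tape
  (inst (unroll (v 2)) ((WScott ⊸ WScott) ⊸ Out) ⊸· on-cell ⊸· on-end ⊸· v 1)))

out-step-⊢ : [] ⨾ [] ⊢ erase out-step ∶ Out ⊸ Out
out-step-⊢ = from-just (typed out-step (Out ⊸ Out))

out-init : ATm
out-init = lam⊸ 0 Cfg (inst (v 0) Out ⊸· lam⊸ 1 ℕˢ (lam⊸ 2 ℕˢ (lam⊸ 3 Tape (lam⊸ 4 Tape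
  (outA (lam⊸ 9 WScott (v 9)) (consᵀ (v 2) (v 4)))))))

out-final : ATm
out-final = lam⊸ 0 Out (inst (v 0) WScott ⊸· lam⊸ 1 (WScott ⊸ WScott) (lam⊸ 2 Tape (v 1 ⊸· εᵂ)))

push-bit : Bool → ATm
push-bit false = lam⊸ 20 Tape (consᵀ (sucˢ zeroˢ) (v 20))
push-bit true = lam⊸ 20 Tape (consᵀ (sucˢ (sucˢ zeroˢ)) (v 20))

input-tape : ℕ → ATm
input-tape w = inst (v w) Tape ⇒· push-bit false ⇒· push-bit true ⊸· nilᵀ

driver-body : ℕ → ℕ → ℕ → ATm
driver-body w₁ w₂ w₃ =
  out-final ⊸· (v 10 ⇒· v w₁ ⊸· (out-init ⊸· (v 11 ⇒· v w₂ ⊸· (v 12 ⊸· input-tape w₃))))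

driver : ATm
driver = lam⇒ 10 (Iterator outputLoop) (lam⇒ 11 (Iterator machineLoop) (lam⇒ 12 (Tape ⊸ Cfg)
  (lam⇒ 13 WChurch (driver-body 13 13 13))))

DriverTy : Ty
DriverTy = Iterator outputLoop ⇒ Iterator machineLoop ⇒ (Tape ⊸ Cfg) ⇒ WChurch ⇒ WScott

driver-⊢ : [] ⨾ [] ⊢ erase driver ∶ DriverTy
driver-⊢ = ⇒ᵢ (⇒ᵢ (⇒ᵢ (⇒ᵢ (from-just body?))))
  where
  Γ₀ : Ctx
  Γ₀ = (10 , Iterator outputLoop) ∷ (11 , Iterator machineLoop) ∷ (12 , Tape ⊸ Cfg) ∷ []
  env : Env
  env = (10 , Iterator outputLoop , unrestricted) ∷ (11 , Iterator machineLoop , unrestricted) ∷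
        (12 , Tape ⊸ Cfg , unrestricted) ∷ (13 , WChurch , unrestricted) ∷
        (14 , WChurch , unrestricted) ∷ (15 , WChurch , unrestricted) ∷ []
  body? : Maybe ((Γ₀ ++ (13 , WChurch) ∷ []) ⨾ [] ⊢ erase (driver-body 13 13 13) ∶ WScott)
  body? = contract? Γ₀ 13 15 13 WChurch
    (contract? (Γ₀ ++ (15 , WChurch) ∷ []) 13 14 13 WChurch
    (check-in? env (driver-body 13 14 15) (Γ₀ ++ (15 , WChurch) ∷ (13 , WChurch) ∷ (14 , WChurch) ∷ []) [] WScott))

cfg-step : ATm → ATm
cfg-step dispatchState = lam⊸ 0 Cfg (inst (v 0) Cfg ⊸· dispatchState)

cfg-init : ATm → ATm
cfg-init q₀ = lam⊸ 0 Tape (inst (unroll (v 0)) Cfg ⊸· lam⊸ 1 ℕˢ (lam⊸ 2 Tape (cfgA q₀ (v 1) nilᵀ (v 2)))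
  ⊸· cfgA q₀ zeroˢ nilᵀ nilᵀ)

module Machine (M : TM) where
  open TM M

  entry : Fin nQ → Fin (3 + k) → Maybe (Fin nQ × Fin (3 + k) × Move) → ATm
  entry q a nothing = halt-entry (numeralA q) (numeralA a)
  entry q a (just (q' , a' , left)) = left-entry (numeralA q') (numeralA a')
  entry q a (just (q' , a' , right)) = right-entry (numeralA q') (numeralA a')

  entry-⊢ : ∀ q a r → [] ⨾ [] ⊢ erase (entry q a r) ∶ Action
  entry-⊢ q a nothing = halt-entry-⊢ q a
  entry-⊢ q a (just (q' , a' , left)) = left-entry-⊢ q' a'
  entry-⊢ q a (just (q' , a' , right)) = right-entry-⊢ q' a'

  on-symbol-⊢ : ∀ q → [] ⨾ [] ⊢ _ ∶ ℕˢ ⊸ Action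
  on-symbol-⊢ q = dispatch-⊢ onSymbol (3 + k) (λ a → entry-⊢ q a (δ q a))

  on-state-⊢ : [] ⨾ [] ⊢ _ ∶ ℕˢ ⊸ ℕˢ ⊸ Action
  on-state-⊢ = dispatch-⊢ onState nQ on-symbol-⊢

  step-⊢ : [] ⨾ [] ⊢ erase (cfg-step ⌞ on-state-⊢ ⌟) ∶ Cfg ⊸ Cfg
  step-⊢ = from-just (typed (cfg-step ⌞ on-state-⊢ ⌟) (Cfg ⊸ Cfg))

  init-⊢ : [] ⨾ [] ⊢ erase (cfg-init (numeralA start)) ∶ Tape ⊸ Cfg
  init-⊢ = from-just (typed (cfg-init (numeralA start)) (Tape ⊸ Cfg))

  module Program (j m₁ m₂ : ℕ) where
    machine-iterator-⊢ : [] ⨾ [] ⊢ iterator machineLoop step-⊢ j m₁ ∶ Iterator machineLoop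
    machine-iterator-⊢ = iterator-⊢ machineLoop step-⊢ j m₁

    output-iterator-⊢ : [] ⨾ [] ⊢ iterator outputLoop out-step-⊢ (suc j) m₂ ∶ Iterator outputLoop
    output-iterator-⊢ = iterator-⊢ outputLoop out-step-⊢ (suc j) m₂

    program : ATm
    program = ⌞ driver-⊢ ⌟ ⇒· ⌞ output-iterator-⊢ ⌟ ⇒· ⌞ machine-iterator-⊢ ⌟ ⇒· ⌞ init-⊢ ⌟

    program-⊢ : [] ⨾ [] ⊢ erase program ∶ WChurch ⇒ WScott
    program-⊢ = from-just (typed program (WChurch ⇒ WScott))

Closed-0 : ∀ {n} t → Closed 0 t → Closed n t
Closed-0 t = Closed-≤ t z≤n

numeralV : ∀ {m} → Fin m → Λ
numeralV i = db (numeral i)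

numeralM : ∀ {m} → Fin m → MTm
numeralM i = ⌜ numeral-⊢ i ⌝

numeralM-zero : ∀ {m} → numeralM (zero {m}) ⟶ₘ mƛ (mƛ (mv 0))
numeralM-zero = ⟶ₘ-reflexive refl

numeralM-suc : ∀ {m} (i : Fin m) → numeralM (suc i) ⟶ₘ mƛ (mƛ (mv 1 m· numeralM i))
numeralM-suc i = ⟶ₘ-reflexive (cong (λ z → ƛ (ƛ (` 1 · z))) (toDB-closed _ (numeral i) (⊢-scoped (numeral-⊢ i))))

Symbol : ℕ → Set
Symbol k = Fin (3 + k)

tapeV : ∀ {m} → List (Fin m) → Λ
tapeV [] = ƛ (ƛ (` 0))
tapeV (a ∷ as) = ƛ (ƛ ((` 1 · numeralV a) · tapeV as))

tapeV-Closed : ∀ {m} (as : List (Fin m)) → Closed 0 (tapeV as)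
tapeV-Closed [] = tt
tapeV-Closed (a ∷ as) =
  ∧-intro (Closed-0 (numeralV a) (⊢-Closed (numeral-⊢ a))) (Closed-0 (tapeV as) (tapeV-Closed as))

tapeM : ∀ {m} → List (Fin m) → MTm
tapeM as = const (tapeV as) (tapeV-Closed as)

tapeM-nil : ∀ {m} → tapeM {m} [] ⟶ₘ mƛ (mƛ (mv 0))
tapeM-nil = ⟶ₘ-reflexive refl

tapeM-cons : ∀ {m} (a : Fin m) as → tapeM (a ∷ as) ⟶ₘ mƛ (mƛ (mv 1 m· numeralM a m· tapeM as))
tapeM-cons a as = ⟶ₘ-reflexive refl

cfgV : ∀ {n m} → Config n m → Λ
cfgV (conf q l a r) = ƛ ((((` 0 · numeralV q) · numeralV a) · tapeV l) · tapeV r)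

cfgV-Closed : ∀ {n m} (c : Config n m) → Closed 0 (cfgV c)
cfgV-Closed (conf q l a r) =
  ∧-intro (∧-intro (∧-intro (Closed-0 (numeralV q) (⊢-Closed (numeral-⊢ q)))
                            (Closed-0 (numeralV a) (⊢-Closed (numeral-⊢ a))))
                   (Closed-0 (tapeV l) (tapeV-Closed l)))
          (Closed-0 (tapeV r) (tapeV-Closed r))

cfgM : ∀ {n m} → Config n m → MTm
cfgM c = const (cfgV c) (cfgV-Closed c)

cfgM-unfold : ∀ {n m} (q : Fin n) l (a : Fin (3 + m)) r →
  cfgM (conf q l a r) ⟶ₘ mƛ (mv 0 m· numeralM q m· numeralM a m· tapeM l m· tapeM r)
cfgM-unfold q l a r = ⟶ₘ-reflexive refl

-- Simulation of one machine step

dispatch-sim : ∀ s m {b : Fin m → Tm} (bd : ∀ i → [] ⨾ [] ⊢ b i ∶ CaseTy s) i →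
  ⌜ dispatch-⊢ s m bd ⌝ m· numeralM i ⟶ₘ ⌜ bd i ⌝
dispatch-sim s (suc m) bd zero =
  appˡ (unfold (dispatch s (suc m) bd) (dispatch-⊢ s (suc m) bd)) ▹ reduce ▹ appˡ² (numeralM-zero {m}) ▹ reduce
dispatch-sim s (suc m) bd (suc i) =
  appˡ (unfold (dispatch s (suc m) bd) (dispatch-⊢ s (suc m) bd)) ▹ reduce ▹ appˡ² (numeralM-suc i) ▹ reduce ▹
  dispatch-sim s m (bd ∘ suc) i

module MachineSimulation (M : TM) where
  open TM M
  open Machine M

  entry-sim : ∀ q a r l rt →
    ⌜ entry-⊢ q a r ⌝ m· tapeM l m· tapeM rt ⟶ₘ cfgM (stepAux (conf q l a rt) r)
  entry-sim q a nothing l rt =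
    appˡ² (unfold (entry q a nothing) (entry-⊢ q a nothing)) ▹ reduce ▹ ⟶ₘ-reflexive refl
  entry-sim q a r@(just (q' , a' , left)) [] rt =
    appˡ² (unfold (entry q a r) (entry-⊢ q a r)) ▹ reduce ▹ appˡ³ (tapeM-nil {3 + k}) ▹ reduce ▹ ⟶ₘ-reflexive refl
  entry-sim q a r@(just (q' , a' , left)) (x ∷ l) rt =
    appˡ² (unfold (entry q a r) (entry-⊢ q a r)) ▹ reduce ▹ appˡ³ (tapeM-cons x l) ▹ reduce ▹ ⟶ₘ-reflexive refl
  entry-sim q a r@(just (q' , a' , right)) l [] =
    appˡ² (unfold (entry q a r) (entry-⊢ q a r)) ▹ reduce ▹ appˡ³ (tapeM-nil {3 + k}) ▹ reduce ▹ ⟶ₘ-reflexive refl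
  entry-sim q a r@(just (q' , a' , right)) l (x ∷ rt) =
    appˡ² (unfold (entry q a r) (entry-⊢ q a r)) ▹ reduce ▹ appˡ³ (tapeM-cons x rt) ▹ reduce ▹ ⟶ₘ-reflexive refl

  step-sim : ∀ c → ⌜ step-⊢ ⌝ m· cfgM c ⟶ₘ cfgM (step M c)
  step-sim (conf q l a r) =
    appˡ (unfold (cfg-step ⌞ on-state-⊢ ⌟) step-⊢) ▹ reduce ▹ appˡ (cfgM-unfold q l a r) ▹ reduce ▹
    appˡ³ (dispatch-sim onState nQ on-symbol-⊢ q) ▹
    appˡ² (dispatch-sim onSymbol (3 + k) (λ b → entry-⊢ q b (δ q b)) a) ▹
    entry-sim q a (δ q a) l r

-- Church words act by iteration

Constant : MTm → Set
Constant (const _ _) = ⊤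
Constant (a m· b) = Constant a × Constant b
Constant (mv _) = ⊥
Constant (mƛ _) = ⊥

mren-constant : ∀ m ρ → Constant m → mren ρ m ≡ m
mren-constant (const _ _) ρ _ = refl
mren-constant (a m· b) ρ (p , q) = cong₂ _m·_ (mren-constant a ρ p) (mren-constant b ρ q)

msub-constant : ∀ m σ → Constant m → msub σ m ≡ m
msub-constant (const _ _) σ _ = refl
msub-constant (a m· b) σ (p , q) = cong₂ _m·_ (msub-constant a σ p) (msub-constant b σ q)

chain : Word → MTm → MTm → MTm → MTm
chain [] g h u = u
chain (b ∷ w) g h u = (if b then h else g) m· chain w g h u

msub-chain : ∀ σ w g h u → msub σ (chain w g h u) ≡ chain w (msub σ g) (msub σ h) (msub σ u)
msub-chain σ [] g h u = refl
msub-chain σ (false ∷ w) g h u = cong (msub σ g m·_) (msub-chain σ w g h u)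
msub-chain σ (true ∷ w) g h u = cong (msub σ h m·_) (msub-chain σ w g h u)

church-apply : ∀ w g h u → Constant g → Constant h →
  mƛ (mƛ (mƛ (chain w (mv 2) (mv 1) (mv 0)))) m· g m· h m· u ⟶ₘ chain w g h u
church-apply w g h u kg kh = appˡ² (βₘ _ g) ▹ appˡ (βₘ _ h) ▹ βₘ _ u ▹ ⟶ₘ-reflexive (cong ⌊_⌋ substituted)
  where
  σ₁ σ₂ σ₃ : ℕ → MTm
  σ₁ = mexts (mexts (msingle g))
  σ₂ = mexts (msingle h)
  σ₃ = msingle u
  g-fixed : msub σ₃ (msub σ₂ (mren suc (mren suc g))) ≡ g
  g-fixed rewrite mren-constant g suc kg | mren-constant g suc kg | msub-constant g σ₂ kg = msub-constant g σ₃ kg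
  h-fixed : msub σ₃ (mren suc h) ≡ h
  h-fixed rewrite mren-constant h suc kh = msub-constant h σ₃ kh
  open ≡-Reasoning
  substituted : msub σ₃ (msub σ₂ (msub σ₁ (chain w (mv 2) (mv 1) (mv 0)))) ≡ chain w g h u
  substituted = begin
    msub σ₃ (msub σ₂ (msub σ₁ (chain w (mv 2) (mv 1) (mv 0))))
      ≡⟨ cong (msub σ₃ ∘ msub σ₂) (msub-chain σ₁ w _ _ _) ⟩
    msub σ₃ (msub σ₂ (chain w (mren suc (mren suc g)) (mv 1) (mv 0)))
      ≡⟨ cong (msub σ₃) (msub-chain σ₂ w _ _ _) ⟩
    msub σ₃ (chain w (msub σ₂ (mren suc (mren suc g))) (mren suc h) (mv 0))
      ≡⟨ msub-chain σ₃ w _ _ _ ⟩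
    chain w (msub σ₃ (msub σ₂ (mren suc (mren suc g)))) (msub σ₃ (mren suc h)) u
      ≡⟨ cong₂ (λ g' h' → chain w g' h' u) g-fixed h-fixed ⟩
    chain w g h u ∎

churchBody-db : ∀ w → toDB (2 ∷ 1 ∷ 0 ∷ []) (churchBody w) ≡ ⌊ chain w (mv 2) (mv 1) (mv 0) ⌋
churchBody-db [] = refl
churchBody-db (false ∷ w) = cong (` 2 ·_) (churchBody-db w)
churchBody-db (true ∷ w) = cong (` 1 ·_) (churchBody-db w)

chain-Closed : ∀ w → Closed 3 ⌊ chain w (mv 2) (mv 1) (mv 0) ⌋
chain-Closed [] = tt
chain-Closed (false ∷ w) = chain-Closed w
chain-Closed (true ∷ w) = chain-Closed w

churchM : Word → MTm
churchM w = const (db (church w)) (transport (Closed 3) (sym (churchBody-db w)) (chain-Closed w))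

churchM-unfold : ∀ w → churchM w ⟶ₘ mƛ (mƛ (mƛ (chain w (mv 2) (mv 1) (mv 0))))
churchM-unfold w = ⟶ₘ-reflexive (cong (ƛ ∘ ƛ ∘ ƛ) (churchBody-db w))

-- The number of iterations performed by iterator s gd j m on a word of length n.
iterations : ℕ → ℕ → ℕ → ℕ
iterations n m zero = m
iterations n m (suc j) = n * iterations n m j + iterations n m j

fold-* : ∀ {A : Set} m n (f : A → A) x → fold x f (m * n) ≡ fold x (λ y → fold y f n) m
fold-* zero n f x = refl
fold-* (suc m) n f x = trans (fold-+ x f n) (cong (λ y → fold y f n) (fold-* m n f x))

amplifierM : MTm
amplifierM = mƛ (mƛ (mƛ (mv 1 m· (mv 2 m· mv 1) m· (mv 2 m· mv 1) m· ((mv 2 m· mv 1) m· mv 0))))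

module Iteration (s : Loop) {A : Set} (enc : A → MTm) (enc-constant : ∀ a → Constant (enc a)) (F : A → A)
  {G : Tm} (gd : [] ⨾ [] ⊢ G ∶ LoopTy s ⊸ LoopTy s) (G-sim : ∀ a → ⌜ gd ⌝ m· enc a ⟶ₘ enc (F a)) where

  power-sim : ∀ m a → ⌜ power-⊢ s gd m ⌝ m· enc a ⟶ₘ enc (fold a F m)
  power-sim zero a = appˡ (unfold (power s gd zero) (power-⊢ s gd zero)) ▹ reduce-by 1
  power-sim (suc m) a =
    appˡ (unfold (power s gd (suc m)) (power-⊢ s gd (suc m))) ▹ reduce-by 1 ▹ appʳ (power-sim m a) ▹ G-sim (fold a F m)

  chain-sim : ∀ (g : MTm) (f : A → A) → (∀ a → g m· enc a ⟶ₘ enc (f a)) →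
    ∀ w a → chain w g g (enc a) ⟶ₘ enc (fold a f (length w))
  chain-sim g f g-sim [] a = ⟶ₘ-refl
  chain-sim g f g-sim (false ∷ w) a = appʳ (chain-sim g f g-sim w a) ▹ g-sim _
  chain-sim g f g-sim (true ∷ w) a = appʳ (chain-sim g f g-sim w a) ▹ g-sim _

  iterator-sim : ∀ j m w a →
    ⌜ iterator-⊢ s gd j m ⌝ m· churchM w m· enc a ⟶ₘ enc (fold a F (iterations (length w) m j))
  iterator-sim zero m w a =
    appˡ² (unfold (iteratorA s gd m) (iterator-⊢ s gd zero m)) ▹ reduce ▹ power-sim m a
  iterator-sim (suc j) m w a =
    appˡ² (⟶ₘ-reflexive {b = amplifierM m· q} refl) ▹ reduce ▹
    appʳ (iterator-sim j m w a) ▹ appˡ³ (churchM-unfold w) ▹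
    church-apply w g g (enc (fold a F c)) (tt , tt) (tt , tt) ▹
    transport (λ z → chain w g g (enc (fold a F c)) ⟶ₘ enc z) (sym count)
      (chain-sim g (λ x → fold x F c) (iterator-sim j m w) w (fold a F c))
    where
    q g : MTm
    q = ⌜ iterator-⊢ s gd j m ⌝
    g = q m· churchM w
    c : ℕ
    c = iterations (length w) m j
    count : fold a F (length w * c + c) ≡ fold (fold a F c) (λ x → fold x F c) (length w)
    count = trans (fold-+ a F (length w * c)) (fold-* (length w) c F (fold a F c))

-- Reading the input and writing the output

bitV : Bool → Λ
bitV b = ƛ (ƛ (ƛ (` (if b then 1 else 2) · ` 3)))

-- The bits read so far, most recent first, as a difference list of Scott words.
accV : List Bool → Λ
accV [] = ƛ (` 0)
accV (b ∷ q) = ƛ (accV q · bitV b)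

accV-Closed : ∀ q → Closed 0 (accV q)
accV-Closed [] = tt
accV-Closed (false ∷ q) = ∧-intro (Closed-0 (accV q) (accV-Closed q)) tt
accV-Closed (true ∷ q) = ∧-intro (Closed-0 (accV q) (accV-Closed q)) tt

accM : List Bool → MTm
accM q = const (accV q) (accV-Closed q)

accM-unfold : ∀ b q → accM (b ∷ q) ⟶ₘ mƛ (accM q m· mƛ (mƛ (mƛ (mv (if b then 1 else 2) m· mv 3))))
accM-unfold false q = ⟶ₘ-reflexive refl
accM-unfold true q = ⟶ₘ-reflexive refl

OutState : ℕ → Set
OutState k = List Bool × List (Symbol k)

outV : ∀ {k} → OutState k → Λ
outV (q , l) = ƛ ((` 0 · accV q) · tapeV l)

outV-Closed : ∀ {k} (o : OutState k) → Closed 0 (outV o)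
outV-Closed (q , l) = ∧-intro (Closed-0 (accV q) (accV-Closed q)) (Closed-0 (tapeV l) (tapeV-Closed l))

outM : ∀ {k} → OutState k → MTm
outM o = const (outV o) (outV-Closed o)

outM-unfold : ∀ {k} (o : OutState k) → outM o ⟶ₘ mƛ (mv 0 m· accM (proj₁ o) m· tapeM (proj₂ o))
outM-unfold (q , l) = ⟶ₘ-reflexive refl

out-stepF : ∀ {k} → OutState k → OutState k
out-stepF (q , []) = (q , [])
out-stepF (q , zero ∷ t) = (q , [])
out-stepF (q , suc zero ∷ t) = (false ∷ q , t)
out-stepF (q , suc (suc zero) ∷ t) = (true ∷ q , t)
out-stepF (q , suc (suc (suc _)) ∷ t) = (q , [])

out-step-sim : ∀ {k} (o : OutState k) → ⌜ out-step-⊢ ⌝ m· outM o ⟶ₘ outM (out-stepF o)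
out-step-sim {k} o@(q , []) =
  appˡ (unfold out-step out-step-⊢) ▹ reduce ▹ appˡ (outM-unfold o) ▹ reduce ▹
  appˡ³ (tapeM-nil {3 + k}) ▹ reduce ▹ ⟶ₘ-reflexive refl
out-step-sim {k} o@(q , a@zero ∷ t) =
  appˡ (unfold out-step out-step-⊢) ▹ reduce ▹ appˡ (outM-unfold o) ▹ reduce ▹ appˡ³ (tapeM-cons a t) ▹ reduce ▹
  appˡ⁴ (numeralM-zero {2 + k}) ▹ reduce ▹ ⟶ₘ-reflexive refl
out-step-sim {k} o@(q , a@(suc zero) ∷ t) =
  appˡ (unfold out-step out-step-⊢) ▹ reduce ▹ appˡ (outM-unfold o) ▹ reduce ▹ appˡ³ (tapeM-cons a t) ▹ reduce ▹
  appˡ⁴ (numeralM-suc {2 + k} zero) ▹ reduce ▹ appˡ⁴ (numeralM-zero {2 + k}) ▹ reduce ▹ ⟶ₘ-reflexive refl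
out-step-sim {k} o@(q , a@(suc (suc zero)) ∷ t) =
  appˡ (unfold out-step out-step-⊢) ▹ reduce ▹ appˡ (outM-unfold o) ▹ reduce ▹ appˡ³ (tapeM-cons a t) ▹ reduce ▹
  appˡ⁴ (numeralM-suc {2 + k} (suc zero)) ▹ reduce ▹ appˡ⁴ (numeralM-suc {2 + k} zero) ▹ reduce ▹
  appˡ⁴ (numeralM-zero {2 + k}) ▹ reduce ▹ ⟶ₘ-reflexive refl
out-step-sim {k} o@(q , a@(suc (suc (suc x))) ∷ t) =
  appˡ (unfold out-step out-step-⊢) ▹ reduce ▹ appˡ (outM-unfold o) ▹ reduce ▹ appˡ³ (tapeM-cons a t) ▹ reduce ▹
  appˡ⁴ (numeralM-suc {2 + k} (suc (suc x))) ▹ reduce ▹ appˡ⁴ (numeralM-suc {1 + k} (suc x)) ▹ reduce ▹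
  appˡ⁴ (numeralM-suc {k} x) ▹ reduce ▹ ⟶ₘ-reflexive refl

scott-scoped : ∀ w → Scoped [] (scott w)
scott-scoped [] = here refl
scott-scoped (false ∷ w) = there (there (here refl)) , Scoped-mono (scott w) (λ ()) (scott-scoped w)
scott-scoped (true ∷ w) = there (here refl) , Scoped-mono (scott w) (λ ()) (scott-scoped w)

scottM : Word → MTm
scottM w = const (db (scott w)) (toDB-Closed [] (scott w) (scott-scoped w))

scottM-cons : ∀ b w → ⌊ mƛ (mƛ (mƛ (mv (if b then 1 else 2) m· scottM w))) ⌋ ≡ db (scott (b ∷ w))
scottM-cons false w = cong (λ z → ƛ (ƛ (ƛ (` 2 · z)))) (sym (toDB-closed _ (scott w) (scott-scoped w)))
scottM-cons true w = cong (λ z → ƛ (ƛ (ƛ (` 1 · z)))) (sym (toDB-closed _ (scott w) (scott-scoped w)))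

accM-apply : ∀ q w → accM q m· scottM w ⟶ₘ scottM (q ʳ++ w)
accM-apply [] w = appˡ (⟶ₘ-reflexive {b = mƛ (mv 0)} refl) ▹ reduce-by 1
accM-apply (false ∷ q) w =
  appˡ (accM-unfold false q) ▹ reduce-by 1 ▹ appʳ (⟶ₘ-reflexive (scottM-cons false w)) ▹ accM-apply q (false ∷ w)
accM-apply (true ∷ q) w =
  appˡ (accM-unfold true q) ▹ reduce-by 1 ▹ appʳ (⟶ₘ-reflexive (scottM-cons true w)) ▹ accM-apply q (true ∷ w)

out-final-sim : ∀ {k} (o : OutState k) → toMTm [] out-final m· outM o ⟶ₘ scottM (proj₁ o ʳ++ [])
out-final-sim o = reduce-by 1 ▹ appˡ (outM-unfold o) ▹ reduce ▹ appʳ (⟶ₘ-reflexive refl) ▹ accM-apply (proj₁ o) []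

out-init-sim : ∀ {n k} (c : Config n k) → toMTm [] out-init m· cfgM c ⟶ₘ outM ([] , Config.hd c ∷ Config.rt c)
out-init-sim (conf q l a r) = reduce-by 1 ▹ appˡ (cfgM-unfold q l a r) ▹ reduce ▹ ⟶ₘ-reflexive refl

push-bitM : Bool → MTm
push-bitM false = const ⌊ toMTm [] (push-bit false) ⌋ tt
push-bitM true = const ⌊ toMTm [] (push-bit true) ⌋ tt

nilM : MTm
nilM = const ⌊ toMTm [] nilᵀ ⌋ tt

input-tape-sim : ∀ k w → churchM w m· toMTm [] (push-bit false) m· toMTm [] (push-bit true) m· toMTm [] nilᵀ
  ⟶ₘ tapeM {3 + k} (map encBit w)
input-tape-sim k w =
  appˡ³ (churchM-unfold w) ▹
  ⟶ₘ-reflexive {b = mƛ (mƛ (mƛ (chain w (mv 2) (mv 1) (mv 0)))) m· push-bitM false m· push-bitM true m· nilM} refl ▹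
  church-apply w (push-bitM false) (push-bitM true) nilM tt tt ▹ pushes w
  where
  pushes : ∀ w → chain w (push-bitM false) (push-bitM true) nilM ⟶ₘ tapeM {3 + k} (map encBit w)
  pushes [] = ⟶ₘ-reflexive refl
  pushes (false ∷ w) = appʳ (pushes w) ▹ appˡ (⟶ₘ-reflexive {b = toMTm [] (push-bit false)} refl) ▹ reduce-by 1 ▹ ⟶ₘ-reflexive refl
  pushes (true ∷ w) = appʳ (pushes w) ▹ appˡ (⟶ₘ-reflexive {b = toMTm [] (push-bit true)} refl) ▹ reduce-by 1 ▹ ⟶ₘ-reflexive refl

module Execution (M : TM) (j m₁ m₂ : ℕ) (w : Word) where
  open TM M
  open Machine M
  open Program j m₁ m₂
  open MachineSimulation M
  private
    module ML = Iteration machineLoop cfgM (λ _ → tt) (step M) step-⊢ step-sim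
    module OL = Iteration outputLoop (outM {k}) (λ _ → tt) out-stepF out-step-⊢ out-step-sim

  init-sim : ∀ w → ⌜ init-⊢ ⌝ m· tapeM (map (encBit {k}) w) ⟶ₘ cfgM (initConf M w)
  init-sim [] =
    appˡ (unfold (cfg-init (numeralA start)) init-⊢) ▹ reduce ▹ appˡ² (tapeM-nil {3 + k}) ▹ reduce ▹ ⟶ₘ-reflexive refl
  init-sim (b ∷ w) =
    appˡ (unfold (cfg-init (numeralA start)) init-⊢) ▹ reduce ▹ appˡ² (tapeM-cons (encBit b) (map encBit w)) ▹ reduce ▹
    ⟶ₘ-reflexive refl

  final-cfg : Config nQ k
  final-cfg = fold (initConf M w) (step M) (iterations (length w) m₁ j)

  final-out : OutState k
  final-out = fold ([] , Config.hd final-cfg ∷ Config.rt final-cfg) out-stepF (iterations (length w) m₂ (suc j))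

  program-sim : ⌜ program-⊢ ⌝ m· churchM w ⟶ₘ scottM (proj₁ final-out ʳ++ [])
  program-sim =
    appˡ (unfold program program-⊢) ▹ appˡ⁴ (unfold driver driver-⊢) ▹ reduce-by 4 ▹
    appʳ (appʳ (appʳ (appʳ (appʳ (input-tape-sim k w))))) ▹
    appʳ (appʳ (appʳ (appʳ (init-sim w)))) ▹
    appʳ (appʳ (appʳ (ML.iterator-sim j m₁ w (initConf M w)))) ▹
    appʳ (appʳ (out-init-sim final-cfg)) ▹
    appʳ (OL.iterator-sim (suc j) m₂ w _) ▹
    out-final-sim final-out

fold-fixpoint : ∀ {A : Set} n (f : A → A) x → f x ≡ x → fold x f n ≡ x
fold-fixpoint zero f x e = refl
fold-fixpoint (suc n) f x e = trans (cong f (fold-fixpoint n f x e)) e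

iterate-fixpoint : ∀ {A : Set} n (f : A → A) x → f x ≡ x → iterate f x n ≡ x
iterate-fixpoint n f x e = trans (sym (iterate-is-fold x f n)) (fold-fixpoint n f x e)

run≡fold : ∀ M n c → run M n c ≡ fold c (step M) n
run≡fold M n c = trans (run≡iterate n c) (sym (iterate-is-fold c (step M) n))
  where
  run≡iterate : ∀ n c → run M n c ≡ iterate (step M) c n
  run≡iterate zero c = refl
  run≡iterate (suc n) c = run≡iterate n (step M c)

step-halted : ∀ M c → Halted M c → step M c ≡ c
step-halted M c h with TM.δ M (Config.st c) (Config.hd c)
step-halted M c refl | .nothing = refl

fold-step-halted : ∀ M {m n} c → m ≤ n → Halted M (fold c (step M) m) → fold c (step M) n ≡ fold c (step M) m
fold-step-halted M {m} {n} c m≤n h = begin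
  fold c (step M) n                         ≡⟨ cong (fold c (step M)) (sym (m∸n+n≡m m≤n)) ⟩
  fold c (step M) (n ∸ m + m)               ≡⟨ fold-+ c (step M) (n ∸ m) ⟩
  fold (fold c (step M) m) (step M) (n ∸ m) ≡⟨ fold-fixpoint (n ∸ m) (step M) _ (step-halted M _ h) ⟩
  fold c (step M) m                         ∎
  where open ≡-Reasoning

module TapeLength (M : TM) where
  open TM M

  stepAux-rt : ∀ (c : Config nQ k) r → length (Config.rt (stepAux c r)) ≤ suc (length (Config.rt c))
  stepAux-rt c nothing = n≤1+n _
  stepAux-rt (conf q [] a rt) (just (q' , a' , left)) = ≤-refl
  stepAux-rt (conf q (x ∷ l) a rt) (just (q' , a' , left)) = ≤-refl
  stepAux-rt (conf q l a []) (just (q' , a' , right)) = z≤n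
  stepAux-rt (conf q l a (x ∷ rt)) (just (q' , a' , right)) = m≤n⇒m≤1+n (n≤1+n _)

  fold-step-rt : ∀ n c → length (Config.rt (fold c (step M) n)) ≤ n + length (Config.rt c)
  fold-step-rt zero c = ≤-refl
  fold-step-rt (suc n) c = ≤-trans (stepAux-rt c' (δ (Config.st c') (Config.hd c'))) (s≤s (fold-step-rt n c))
    where
    c' : Config nQ k
    c' = fold c (step M) n

  initConf-rt : ∀ w → length (Config.rt (initConf M w)) ≤ length w
  initConf-rt [] = z≤n
  initConf-rt (b ∷ w) = transport (_≤ suc (length w)) (sym (length-map encBit w)) (n≤1+n _)

iterate-out-step : ∀ {k} (l : List (Symbol k)) q n → length l ≤ n →
  iterate out-stepF (q , l) n ≡ (readBits l ʳ++ q , [])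
iterate-out-step [] q n _ = iterate-fixpoint n out-stepF (q , []) refl
iterate-out-step (zero ∷ t) q (suc n) _ = iterate-fixpoint n out-stepF (q , []) refl
iterate-out-step (suc zero ∷ t) q (suc n) (s≤s l≤n) = iterate-out-step t (false ∷ q) n l≤n
iterate-out-step (suc (suc zero) ∷ t) q (suc n) (s≤s l≤n) = iterate-out-step t (true ∷ q) n l≤n
iterate-out-step (suc (suc (suc _)) ∷ t) q (suc n) _ = iterate-fixpoint n out-stepF (q , []) refl

iterations-≥ : ∀ n m j → m ≤ iterations n m j
iterations-≥ n m zero = ≤-refl
iterations-≥ n m (suc j) = ≤-trans (iterations-≥ n m j) (m≤n+m _ _)

iterations-^ : ∀ n m j → n ^ j * m ≤ iterations n m j
iterations-^ n m zero = ≤-reflexive (+-comm m 0)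
iterations-^ n m (suc j) = begin
  n ^ suc j * m          ≡⟨ *-assoc n (n ^ j) m ⟩
  n * (n ^ j * m)        ≤⟨ *-monoʳ-≤ n (iterations-^ n m j) ⟩
  n * iterations n m j   ≤⟨ m≤m+n _ _ ⟩
  iterations n m (suc j) ∎
  where open ≤-Reasoning

iterations-+ : ∀ n a b j → iterations n (a + b) j ≡ iterations n a j + iterations n b j
iterations-+ n a b zero = refl
iterations-+ n a b (suc j) rewrite iterations-+ n a b j = distrib (iterations n a j) (iterations n b j)
  where
  open +-*-Solver
  distrib : ∀ x y → n * (x + y) + (x + y) ≡ (n * x + x) + (n * y + y)
  distrib = solve 3 (λ n' x y → n' :* (x :+ y) :+ (x :+ y) := (n' :* x :+ x) :+ (n' :* y :+ y)) refl n

time-bound : ∀ n c d → c * n ^ d + c ≤ iterations n (c + c) d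
time-bound n c d rewrite iterations-+ n c c d =
  +-mono-≤ (transport (_≤ iterations n c d) (*-comm (n ^ d) c) (iterations-^ n c d)) (iterations-≥ n c d)

-- The output phase must also see the scanned cell and the n input cells.
output-bound : ∀ n c d → suc (iterations n (c + c) d + n) ≤ iterations n (suc (c + c)) (suc d)
output-bound n c d = begin
  suc (X + n)            ≡⟨ cong suc (+-comm X n) ⟩
  suc (n + X)            ≡⟨ sym (+-suc n X) ⟩
  n + suc X              ≤⟨ +-mono-≤ (transport (_≤ n * (Y + X)) (*-identityʳ n) (*-monoʳ-≤ n 1≤Y+X))
                                     (+-monoˡ-≤ X 1≤Y) ⟩
  n * (Y + X) + (Y + X)  ≡⟨ cong (λ z → n * z + z) (sym (iterations-+ n 1 (c + c) d)) ⟩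
  iterations n (suc (c + c)) (suc d) ∎
  where
  open ≤-Reasoning
  X Y : ℕ
  X = iterations n (c + c) d
  Y = iterations n 1 d
  1≤Y : 1 ≤ Y
  1≤Y = iterations-≥ n 1 d
  1≤Y+X : 1 ≤ Y + X
  1≤Y+X = ≤-trans 1≤Y (m≤m+n Y X)

-- β-normal forms

data Neutral : Λ → Set
data Normal : Λ → Set

data Neutral where
  var : ∀ i → Neutral (` i)
  app : ∀ {t u} → Neutral t → Normal u → Neutral (t · u)

data Normal where
  ne : ∀ {t} → Neutral t → Normal t
  lam : ∀ {t} → Normal t → Normal (ƛ t)

Neutral⇒BetaNormal : ∀ {t} → Neutral t → BetaNormal t
Normal⇒BetaNormal : ∀ {t} → Normal t → BetaNormal t

Neutral⇒BetaNormal (app () _) t' β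
Neutral⇒BetaNormal (app n _) t' (ξₗ s) = Neutral⇒BetaNormal n _ s
Neutral⇒BetaNormal (app _ m) t' (ξᵣ s) = Normal⇒BetaNormal m _ s

Normal⇒BetaNormal (ne n) = Neutral⇒BetaNormal n
Normal⇒BetaNormal (lam m) t' (ξƛ s) = Normal⇒BetaNormal m _ s

scott-Normal : ∀ w → Normal (db (scott w))
scott-Normal [] = lam (lam (lam (ne (var 0))))
scott-Normal (false ∷ w) rewrite toDB-closed (2 ∷ 1 ∷ 0 ∷ []) (scott w) (scott-scoped w) =
  lam (lam (lam (ne (app (var 2) (scott-Normal w)))))
scott-Normal (true ∷ w) rewrite toDB-closed (2 ∷ 1 ∷ 0 ∷ []) (scott w) (scott-scoped w) =
  lam (lam (lam (ne (app (var 1) (scott-Normal w)))))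

module Correctness (f : Word → Word) (M : TM) (c d : ℕ) (comp : ComputesInTime M (λ n → c * n ^ d + c) f)
  (w : Word) where
  open TM M
  open TapeLength M
  open Machine.Program M d (c + c) (suc (c + c))
  open Execution M d (c + c) (suc (c + c)) w

  cells : List (Symbol k)
  cells = Config.hd final-cfg ∷ Config.rt final-cfg

  final-cfg-halted : final-cfg ≡ run M (proj₁ (comp w)) (initConf M w)
  final-cfg-halted with comp w
  ... | n , n≤T , halted , _ = begin
    final-cfg ≡⟨ fold-step-halted M (initConf M w) (≤-trans n≤T (time-bound (length w) c d))
                   (transport (Halted M) (run≡fold M n (initConf M w)) halted) ⟩
    fold (initConf M w) (step M) n ≡⟨ sym (run≡fold M n (initConf M w)) ⟩
    run M n (initConf M w) ∎
    where open ≡-Reasoning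

  output-steps : ℕ
  output-steps = iterations (length w) (suc (c + c)) (suc d)

  cells-bound : length cells ≤ output-steps
  cells-bound = ≤-trans (s≤s (≤-trans (fold-step-rt _ (initConf M w)) (+-mono-≤ ≤-refl (initConf-rt w))))
                        (output-bound (length w) c d)

  output-correct : proj₁ final-out ʳ++ [] ≡ f w
  output-correct = begin
    proj₁ final-out ʳ++ []
      ≡⟨ cong (λ o → proj₁ o ʳ++ []) (trans (iterate-is-fold ([] , cells) out-stepF output-steps)
                                            (iterate-out-step cells [] output-steps cells-bound)) ⟩
    (readBits cells ʳ++ []) ʳ++ []        ≡⟨ reverse-involutive (readBits cells) ⟩
    output final-cfg                      ≡⟨ cong output final-cfg-halted ⟩
    output (run M (proj₁ (comp w)) (initConf M w)) ≡⟨ proj₂ (proj₂ (proj₂ (comp w))) ⟩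
    f w ∎
    where open ≡-Reasoning

  program-reduces : toDB [] (app (erase program) (church w)) ⟶β* db (scott (f w))
  program-reduces = transport (λ v → toDB [] (app (erase program) (church w)) ⟶β* db (scott v))
    output-correct (reduces program-sim)

theorem2 : (f : Word → Word) → PolyTimeComputable f →
    Σ Tm (λ t → ([] ⨾ [] ⊢ t ∶ WChurch ⇒ WScott)
    × (∀ w → IsBetaNF (toDB [] (app t (church w))) (toDB [] (scott (f w)))))
theorem2 f (M , c , d , comp) = erase program , program-⊢ , λ w →
  Correctness.program-reduces f M c d comp w , Normal⇒BetaNormal (scott-Normal (f w))
  where open Machine.Program M d (c + c) (suc (c + c))
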